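{- Let $K$ be a field, $M=M_3(K)$, $L=M\otimes M\otimes M$ (factors $L_1,L_2,L_3$), and let $\mathcal L=\{t_1,\dots,t_{23}\}$ be the Laderman algorithm listed in the context. Let $\mathrm{Aut}(\mathcal L)$ be the group of decomposable automorphisms $g$ of $L$ with $g(\mathcal L)=\mathcal L$, let $\mathrm{Aut}(\mathcal L)_0$ be its subgroup of elements corresponding to the identity permutation of $\{L_1,L_2,L_3\}$, and let $Q_1=\langle\Phi_3,\Phi_4\rangle$. Then $\mathrm{Aut}(\mathcal L)=\mathrm{Aut}(\mathcal L)_0Q_1$.
   Context: A decomposable automorphism of $L_1\otimes L_2\otimes L_3$ is a linear automorphism $\varphi$ for which there are a permutation $\tau$ of $\{1,2,3\}$ and isomorphisms $\varphi_i:L_i\to L_{\tau(i)}$ with $\varphi(u_1\otimes u_2\otimes u_3)$ equal to the tensor whose $\tau(i)$-th factor is $\varphi_i(u_i)$; $\tau$ is its permutation of factors (uniquely determined here). $e_{ij}$ are matrix units of $M_3(K)$. Tensors: $t_1=(e_{11}+e_{12}+e_{13}-e_{21}-e_{22}-e_{32}-e_{33})\otimes e_{22}\otimes e_{21}$; $t_2=(e_{11}-e_{21})\otimes(-e_{12}+e_{22})\otimes(e_{12}+e_{22})$; $t_3=e_{22}\otimes(-e_{11}+e_{12}+e_{21}-e_{22}-e_{23}-e_{31}+e_{33})\otimes e_{12}$; $t_4=(-e_{11}+e_{21}+e_{22})\otimes(e_{11}-e_{12}+e_{22})\otimes(e_{21}+e_{12}+e_{22})$; $t_5=(e_{21}+e_{22})\otimes(-e_{11}+e_{12})\otimes(e_{21}+e_{22})$;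 $t_6=e_{11}\otimes e_{11}\otimes(e_{11}+e_{21}+e_{31}+e_{12}+e_{22}+e_{13}+e_{33})$; $t_7=(-e_{11}+e_{31}+e_{32})\otimes(e_{11}-e_{13}+e_{23})\otimes(e_{31}+e_{13}+e_{33})$; $t_8=(-e_{11}+e_{31})\otimes(e_{13}-e_{23})\otimes(e_{13}+e_{33})$; $t_9=(e_{31}+e_{32})\otimes(-e_{11}+e_{13})\otimes(e_{31}+e_{33})$; $t_{10}=(e_{11}+e_{12}+e_{13}-e_{22}-e_{23}-e_{31}-e_{32})\otimes e_{23}\otimes e_{31}$; $t_{11}=e_{32}\otimes(-e_{11}+e_{13}+e_{21}-e_{22}-e_{23}-e_{31}+e_{32})\otimes e_{13}$; $t_{12}=(-e_{13}+e_{32}+e_{33})\otimes(e_{22}+e_{31}-e_{32})\otimes(e_{21}+e_{13}+e_{23})$; $t_{13}=(e_{13}-e_{33})\otimes(e_{22}-e_{32})\otimes(e_{13}+e_{23})$; $t_{14}=e_{13}\otimes e_{31}\otimes(e_{11}+e_{21}+e_{31}+e_{12}+e_{32}+e_{13}+e_{23})$; $t_{15}=(e_{32}+e_{33})\otimes(-e_{31}+e_{32})\otimes(e_{21}+e_{23})$; $t_{16}=(-e_{13}+e_{22}+e_{23})\otimes(e_{23}+e_{31}-e_{33})\otimes(e_{31}+e_{12}+e_{32})$; $t_{17}=(e_{13}-e_{23})\otimes(e_{23}-e_{33})\otimes(e_{12}+e_{32})$; $t_{18}=(e_{22}+e_{23})\otimes(-e_{31}+e_{33})\otimes(e_{31}+e_{32})$;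 $t_{19}=e_{12}\otimes e_{21}\otimes e_{11}$; $t_{20}=e_{23}\otimes e_{32}\otimes e_{22}$; $t_{21}=e_{21}\otimes e_{13}\otimes e_{32}$; $t_{22}=e_{31}\otimes e_{12}\otimes e_{23}$; $t_{23}=e_{33}\otimes e_{33}\otimes e_{33}$. $\pi_{12}=e_{12}+e_{21}+e_{33}$, $\varepsilon_1=\mathrm{diag}(-1,1,1)$, $\varepsilon_2=\mathrm{diag}(1,-1,1)$; $\Phi_3(x\otimes y\otimes z)=y^t\varepsilon_2\otimes\varepsilon_2x^t\otimes z^t$, $\Phi_4(x\otimes y\otimes z)=\varepsilon_1z\pi_{12}\otimes\pi_{12}x\pi_{12}\varepsilon_1\otimes\varepsilon_1\pi_{12}y\varepsilon_1$. -}

module Defs where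

open import Level using (Level; _⊔_) renaming (suc to lsuc)
open import Algebra.Bundles using (CommutativeRing)
open import Data.Fin using (Fin; zero; suc)
open import Data.Fin.Permutation using (Permutation′; _⟨$⟩ʳ_; _⟨$⟩ˡ_)
open import Data.Product using (Σ; _×_; _,_; ∃)
open import Data.List using (List; []; _∷_)
open import Data.List.Relation.Unary.Any using (Any)
open import Data.List.Relation.Unary.All using (All)
open import Relation.Nullary using (¬_)
open import Relation.Binary.PropositionalEquality using (_≡_)
open import Function using (_∘_; id)

record Field (c ℓ : Level) : Set (lsuc (c ⊔ ℓ)) where
  field
    commutativeRing : CommutativeRing c ℓ
  open CommutativeRing commutativeRing public
  field
    1≉0     : ¬ (1# ≈ 0#)
    inverse : ∀ x → ¬ (x ≈ 0#) → Σ Carrier (λ y → x * y ≈ 1#)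

module Setup {c ℓ : Level} (F : Field c ℓ) where
  open Field F using (Carrier; _≈_; _+_; _*_; -_; _-_; 0#; 1#)

  Vect : Set → Set c
  Vect I = I → Carrier

  _≈ᵛ_ : ∀ {I} → Vect I → Vect I → Set ℓ
  u ≈ᵛ v = ∀ i → u i ≈ v i

  _+ᵛ_ : ∀ {I} → Vect I → Vect I → Vect I
  (u +ᵛ v) i = u i + v i

  _·ᵛ_ : ∀ {I} → Carrier → Vect I → Vect I
  (a ·ᵛ v) i = a * v i

  record IsLinear {I J : Set} (f : Vect I → Vect J) : Set (c ⊔ ℓ) where
    field
      cong     : ∀ {u v} → u ≈ᵛ v → f u ≈ᵛ f v
      additive : ∀ u v → f (u +ᵛ v) ≈ᵛ (f u +ᵛ f v)
      homog    : ∀ a v → f (a ·ᵛ v) ≈ᵛ (a ·ᵛ f v)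

  record IsLinIso {I J : Set} (f : Vect I → Vect J) : Set (c ⊔ ℓ) where
    field
      linear   : IsLinear f
      inv      : Vect J → Vect I
      inv-cong : ∀ {u v} → u ≈ᵛ v → inv u ≈ᵛ inv v
      inv-l    : ∀ v → inv (f v) ≈ᵛ v
      inv-r    : ∀ w → f (inv w) ≈ᵛ w

  -- matrix indices (row, column), M = M₃(K), L = M ⊗ M ⊗ M
  Idx : Set
  Idx = Fin 3 × Fin 3

  M : Set c
  M = Vect Idx

  L : Set c
  L = Vect (Idx × Idx × Idx)

  _≈L_ : L → L → Set ℓ
  _≈L_ = _≈ᵛ_

  _⊗_⊗_ : M → M → M → L
  (x ⊗ y ⊗ z) (a , b , d) = x a * y b * z d

  ⊗ᶠ : (Fin 3 → M) → L
  ⊗ᶠ u = u zero ⊗ u (suc zero) ⊗ u (suc (suc zero))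

  δ : ∀ {n} → Fin n → Fin n → Carrier
  δ zero zero = 1#
  δ (suc i) (suc j) = δ i j
  δ zero (suc j) = 0#
  δ (suc i) zero = 0#

  -- matrix unit e_{ij} (0-based indices)
  E : Fin 3 → Fin 3 → M
  E i j (k , l) = δ i k * δ j l

  Σ₃ : (Fin 3 → Carrier) → Carrier
  Σ₃ f = f zero + (f (suc zero) + f (suc (suc zero)))

  ΣIdx : (Idx → Carrier) → Carrier
  ΣIdx f = Σ₃ (λ i → Σ₃ (λ j → f (i , j)))

  _·ₘ_ : M → M → M
  (A ·ₘ B) (i , j) = Σ₃ (λ k → A (i , k) * B (k , j))

  _ᵗ : M → M
  (A ᵗ) (i , j) = A (j , i)

  _+ₘ_ _-ₘ_ : M → M → M
  A +ₘ B = A +ᵛ B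
  (A -ₘ B) k = A k - B k

  -ₘ_ : M → M
  (-ₘ A) k = - A k

  infixl 6 _+ₘ_ _-ₘ_
  infix 8 -ₘ_

  -- named matrix units, 1-based as in the paper
  e11 e12 e13 e21 e22 e23 e31 e32 e33 : M
  e11 = E zero zero
  e12 = E zero (suc zero)
  e13 = E zero (suc (suc zero))
  e21 = E (suc zero) zero
  e22 = E (suc zero) (suc zero)
  e23 = E (suc zero) (suc (suc zero))
  e31 = E (suc (suc zero)) zero
  e32 = E (suc (suc zero)) (suc zero)
  e33 = E (suc (suc zero)) (suc (suc zero))

  linExt : (M → M → M → L) → L → L
  linExt f T w =
    ΣIdx (λ a → ΣIdx (λ b → ΣIdx (λ d →
      T (a , b , d) * f (E (Data.Product.proj₁ a) (Data.Product.proj₂ a))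
                        (E (Data.Product.proj₁ b) (Data.Product.proj₂ b))
                        (E (Data.Product.proj₁ d) (Data.Product.proj₂ d)) w)))

  t1 t2 t3 t4 t5 t6 t7 t8 t9 t10 t11 t12 t13 t14 t15 t16 t17 t18
    t19 t20 t21 t22 t23 : L
  t1 = (e11 +ₘ e12 +ₘ e13 -ₘ e21 -ₘ e22 -ₘ e32 -ₘ e33) ⊗ e22 ⊗ e21
  t2 = (e11 -ₘ e21) ⊗ (-ₘ e12 +ₘ e22) ⊗ (e12 +ₘ e22)
  t3 = e22 ⊗ (-ₘ e11 +ₘ e12 +ₘ e21 -ₘ e22 -ₘ e23 -ₘ e31 +ₘ e33) ⊗ e12
  t4 = (-ₘ e11 +ₘ e21 +ₘ e22) ⊗ (e11 -ₘ e12 +ₘ e22) ⊗ (e21 +ₘ e12 +ₘ e22)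
  t5 = (e21 +ₘ e22) ⊗ (-ₘ e11 +ₘ e12) ⊗ (e21 +ₘ e22)
  t6 = e11 ⊗ e11 ⊗ (e11 +ₘ e21 +ₘ e31 +ₘ e12 +ₘ e22 +ₘ e13 +ₘ e33)
  t7 = (-ₘ e11 +ₘ e31 +ₘ e32) ⊗ (e11 -ₘ e13 +ₘ e23) ⊗ (e31 +ₘ e13 +ₘ e33)
  t8 = (-ₘ e11 +ₘ e31) ⊗ (e13 -ₘ e23) ⊗ (e13 +ₘ e33)
  t9 = (e31 +ₘ e32) ⊗ (-ₘ e11 +ₘ e13) ⊗ (e31 +ₘ e33)
  t10 = (e11 +ₘ e12 +ₘ e13 -ₘ e22 -ₘ e23 -ₘ e31 -ₘ e32) ⊗ e23 ⊗ e31
  t11 = e32 ⊗ (-ₘ e11 +ₘ e13 +ₘ e21 -ₘ e22 -ₘ e23 -ₘ e31 +ₘ e32) ⊗ e13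
  t12 = (-ₘ e13 +ₘ e32 +ₘ e33) ⊗ (e22 +ₘ e31 -ₘ e32) ⊗ (e21 +ₘ e13 +ₘ e23)
  t13 = (e13 -ₘ e33) ⊗ (e22 -ₘ e32) ⊗ (e13 +ₘ e23)
  t14 = e13 ⊗ e31 ⊗ (e11 +ₘ e21 +ₘ e31 +ₘ e12 +ₘ e32 +ₘ e13 +ₘ e23)
  t15 = (e32 +ₘ e33) ⊗ (-ₘ e31 +ₘ e32) ⊗ (e21 +ₘ e23)
  t16 = (-ₘ e13 +ₘ e22 +ₘ e23) ⊗ (e23 +ₘ e31 -ₘ e33) ⊗ (e31 +ₘ e12 +ₘ e32)
  t17 = (e13 -ₘ e23) ⊗ (e23 -ₘ e33) ⊗ (e12 +ₘ e32)
  t18 = (e22 +ₘ e23) ⊗ (-ₘ e31 +ₘ e33) ⊗ (e31 +ₘ e32)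
  t19 = e12 ⊗ e21 ⊗ e11
  t20 = e23 ⊗ e32 ⊗ e22
  t21 = e21 ⊗ e13 ⊗ e32
  t22 = e31 ⊗ e12 ⊗ e23
  t23 = e33 ⊗ e33 ⊗ e33

  Laderman : List L
  Laderman = t1 ∷ t2 ∷ t3 ∷ t4 ∷ t5 ∷ t6 ∷ t7 ∷ t8 ∷ t9 ∷ t10 ∷ t11 ∷ t12 ∷
             t13 ∷ t14 ∷ t15 ∷ t16 ∷ t17 ∷ t18 ∷ t19 ∷ t20 ∷ t21 ∷ t22 ∷
             t23 ∷ []

  _∈𝓛 : L → Set (c ⊔ ℓ)
  T ∈𝓛 = Any (λ t → T ≈L t) Laderman

  Preserves𝓛 : (L → L) → Set (c ⊔ ℓ)
  Preserves𝓛 g = All (λ t → g t ∈𝓛) Laderman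
               × All (λ t → Any (λ s → g s ≈L t) Laderman) Laderman

  -- g(u₁ ⊗ u₂ ⊗ u₃) = tensor whose τ(i)-th factor is φᵢ(uᵢ)
  record Decomposition (g : L → L) : Set (c ⊔ ℓ) where
    field
      τ      : Permutation′ 3
      φ      : Fin 3 → M → M
      φ-iso  : ∀ i → IsLinIso (φ i)
      action : ∀ (u : Fin 3 → M) →
               g (⊗ᶠ u) ≈L ⊗ᶠ (λ k → φ (τ ⟨$⟩ˡ k) (u (τ ⟨$⟩ˡ k)))

  IsDecomposableAut : (L → L) → Set (c ⊔ ℓ)
  IsDecomposableAut g = IsLinIso g × Decomposition g

  InAut𝓛 : (L → L) → Set (c ⊔ ℓ)
  InAut𝓛 g = IsDecomposableAut g × Preserves𝓛 g

  InAut𝓛₀ : (L → L) → Set (c ⊔ ℓ)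
  InAut𝓛₀ g = IsLinIso g × Preserves𝓛 g
            × Σ (Decomposition g)
                (λ d → ∀ i → Decomposition.τ d ⟨$⟩ʳ i ≡ i)

  π12 ε1 ε2 : M
  π12 = e12 +ₘ e21 +ₘ e33
  ε1 = -ₘ e11 +ₘ e22 +ₘ e33
  ε2 = e11 -ₘ e22 +ₘ e33

  Φ3 Φ4 : L → L
  Φ3 = linExt (λ x y z → ((y ᵗ) ·ₘ ε2) ⊗ (ε2 ·ₘ (x ᵗ)) ⊗ (z ᵗ))
  Φ4 = linExt (λ x y z → ((ε1 ·ₘ z) ·ₘ π12)
                         ⊗ (((π12 ·ₘ x) ·ₘ π12) ·ₘ ε1)
                         ⊗ ((ε1 ·ₘ π12) ·ₘ (y ·ₘ ε1)))

  -- the subgroup of the group of (setoid) automorphisms of L generated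
  -- by Φ₃ and Φ₄; elements are considered up to pointwise equality
  data InQ1 : (L → L) → Set (c ⊔ ℓ) where
    gen3 : InQ1 Φ3
    gen4 : InQ1 Φ4
    one  : InQ1 id
    comp : ∀ {f h} → InQ1 f → InQ1 h → InQ1 (f ∘ h)
    inv  : ∀ {f} h → InQ1 f → (∀ {u v} → u ≈L v → h u ≈L h v) →
           (∀ T → f (h T) ≈L T) → (∀ T → h (f T) ≈L T) → InQ1 h
    resp : ∀ {f} h → InQ1 f → (∀ T → f T ≈L h T) → InQ1 h

  Aut𝓛≡Aut𝓛₀Q1 : Set (c ⊔ ℓ)
  Aut𝓛≡Aut𝓛₀Q1 =
    (∀ g → InAut𝓛 g →
       Σ (L → L) (λ g₀ → Σ (L → L) (λ q →
         InAut𝓛₀ g₀ × InQ1 q × (∀ T → g T ≈L g₀ (q T)))))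
    × (∀ g₀ q → InAut𝓛₀ g₀ → InQ1 q → InAut𝓛 (g₀ ∘ q))

-- A decomposable automorphism g has a well-defined permutation of factors τ_g,
-- and τ is multiplicative, so Aut(𝓛)₀ is the kernel of g ↦ τ_g on the group Aut(𝓛).
-- Φ₃ and Φ₄ are decomposable: each is the linear extension of a trilinear map that permutes
-- the factors and applies invertible maps x ↦ A x B or x ↦ A xᵗ B to them; and each permutes
-- the 23 tensors of 𝓛, which is checked by evaluating integer matrices. Their permutations
-- of factors, a transposition and a 3-cycle, generate S₃. Hence every g ∈ Aut(𝓛) has some
-- q ∈ Q₁ with τ_q = τ_g, and g = (g q⁻¹) q with g q⁻¹ ∈ Aut(𝓛)₀; conversely Aut(𝓛)₀ Q₁ ⊆ Aut(𝓛)
-- because Aut(𝓛) is closed under composition, inverses and pointwise equality.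

module Submission where

open import Defs
open import Level using (_⊔_)
open import Algebra using (Ring; CommutativeRing)
open import Data.Nat as ℕ using (ℕ; zero; suc)
import Data.Nat.Properties as ℕ
open import Data.Integer as ℤ using (ℤ; +_; -[1+_]; _◃_)
import Data.Integer.Properties as ℤ
import Data.Sign as Sign
open import Data.Fin as Fin using (Fin; zero; suc; #_)
open import Data.Fin.Patterns using (0F; 1F; 2F)
open import Data.Fin.Properties using (all?)
import Data.Fin.Permutation as Perm
open import Data.Fin.Permutation
  using (Permutation′; _⟨$⟩ʳ_; _⟨$⟩ˡ_; inverseˡ; inverseʳ; flip; transpose; _∘ₚ_)
open import Data.Product using (Σ; _×_; _,_; proj₁; proj₂)
open import Data.Vec using (Vec)
import Data.Vec as Vec
import Data.Vec.Properties as Vec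
open import Data.Vec.Functional using ([]; _∷_)
open import Data.List as List using (List)
open import Data.List.Relation.Unary.All using (All)
import Data.List.Relation.Unary.All as All
import Data.List.Relation.Unary.All.Properties as All
open import Data.List.Relation.Unary.Any using (Any)
import Data.List.Relation.Unary.Any as Any
import Data.List.Relation.Unary.Any.Properties as Any
open import Function using (_∘_; id)
open import Relation.Binary.Bundles using (Setoid)
open import Relation.Binary.PropositionalEquality as ≡ using (_≡_)
open import Relation.Nullary using (Dec; contradiction)
open import Relation.Nullary.Decidable using (map′; from-yes)

module IntegerCast {c ℓ} (R : Ring c ℓ) where
  open Ring R
  open import Algebra.Properties.Ring R
    using (-‿distribˡ-*; -‿distribʳ-*; -‿involutive; -0#≈0#; -‿anti-homo-+)
  open import Algebra.Properties.Semiring.Mult.TCOptimised semiring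
    using (×-homo-+; ×1-homo-*) renaming (_×_ to _×ₙ_)
  open import Relation.Binary.Reasoning.Setoid setoid

  fromℕ : ℕ → Carrier
  fromℕ n = n ×ₙ 1#

  fromℤ : ℤ → Carrier
  fromℤ (+ n)    = fromℕ n
  fromℤ -[1+ n ] = - fromℕ (suc n)

  fromℤ-neg : ∀ z → fromℤ (ℤ.- z) ≈ - fromℤ z
  fromℤ-neg (+ zero)  = sym -0#≈0#
  fromℤ-neg (+ suc n) = refl
  fromℤ-neg -[1+ n ]  = sym (-‿involutive _)

  private
    x+y-[x+z]≈y-z : ∀ a b d → (a + b) - (a + d) ≈ b - d
    x+y-[x+z]≈y-z a b d = begin
      (a + b) + - (a + d)    ≈⟨ +-congˡ (-‿anti-homo-+ a d) ⟩
      (a + b) + (- d + - a)  ≈⟨ +-assoc a b _ ⟩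
      a + (b + (- d + - a))  ≈⟨ +-congˡ (sym (+-assoc b _ _)) ⟩
      a + ((b - d) + - a)    ≈⟨ +-congˡ (+-comm _ _) ⟩
      a + (- a + (b - d))    ≈⟨ sym (+-assoc a _ _) ⟩
      (a - a) + (b - d)      ≈⟨ +-congʳ (-‿inverseʳ a) ⟩
      0# + (b - d)           ≈⟨ +-identityˡ _ ⟩
      b - d                  ∎

  fromℤ-⊖ : ∀ m n → fromℤ (m ℤ.⊖ n) ≈ fromℕ m - fromℕ n
  fromℤ-⊖ zero    zero    = sym (trans (+-congˡ -0#≈0#) (+-identityʳ _))
  fromℤ-⊖ (suc m) zero    = sym (trans (+-congˡ -0#≈0#) (+-identityʳ _))
  fromℤ-⊖ zero    (suc n) = sym (+-identityˡ _)
  fromℤ-⊖ (suc m) (suc n) = begin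
    fromℤ (suc m ℤ.⊖ suc n)         ≡⟨ ≡.cong fromℤ (ℤ.[1+m]⊖[1+n]≡m⊖n m n) ⟩
    fromℤ (m ℤ.⊖ n)                 ≈⟨ fromℤ-⊖ m n ⟩
    fromℕ m - fromℕ n               ≈⟨ x+y-[x+z]≈y-z 1# (fromℕ m) (fromℕ n) ⟨
    (1# + fromℕ m) - (1# + fromℕ n) ≈⟨ +-congˡ (-‿cong (×-homo-+ 1# 1 n)) ⟨
    (1# + fromℕ m) - fromℕ (suc n)  ≈⟨ +-congʳ (×-homo-+ 1# 1 m) ⟨
    fromℕ (suc m) - fromℕ (suc n)   ∎

  fromℤ-+ : ∀ a b → fromℤ (a ℤ.+ b) ≈ fromℤ a + fromℤ b
  fromℤ-+ (+ m)    (+ n)    = ×-homo-+ 1# m n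
  fromℤ-+ (+ m)    -[1+ n ] = fromℤ-⊖ m (suc n)
  fromℤ-+ -[1+ m ] (+ n)    = trans (fromℤ-⊖ n (suc m)) (+-comm _ _)
  fromℤ-+ -[1+ m ] -[1+ n ] = begin
    - fromℕ (suc (suc (m ℕ.+ n)))     ≡⟨ ≡.cong (λ k → - fromℕ k) (≡.sym (ℕ.+-suc (suc m) n)) ⟩
    - fromℕ (suc m ℕ.+ suc n)         ≈⟨ -‿cong (×-homo-+ 1# (suc m) (suc n)) ⟩
    - (fromℕ (suc m) + fromℕ (suc n)) ≈⟨ -‿anti-homo-+ _ _ ⟩
    - fromℕ (suc n) + - fromℕ (suc m) ≈⟨ +-comm _ _ ⟩
    - fromℕ (suc m) + - fromℕ (suc n) ∎

  private
    fromℤ-+◃ : ∀ k → fromℤ (Sign.+ ◃ k) ≈ fromℕ k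
    fromℤ-+◃ zero    = refl
    fromℤ-+◃ (suc k) = refl

    fromℤ--◃ : ∀ k → fromℤ (Sign.- ◃ k) ≈ - fromℕ k
    fromℤ--◃ zero    = sym -0#≈0#
    fromℤ--◃ (suc k) = refl

  fromℤ-* : ∀ a b → fromℤ (a ℤ.* b) ≈ fromℤ a * fromℤ b
  fromℤ-* (+ m) (+ n) = trans (fromℤ-+◃ (m ℕ.* n)) (×1-homo-* m n)
  fromℤ-* (+ m) -[1+ n ] = begin
    fromℤ (Sign.- ◃ (m ℕ.* suc n)) ≈⟨ fromℤ--◃ (m ℕ.* suc n) ⟩
    - fromℕ (m ℕ.* suc n)          ≈⟨ -‿cong (×1-homo-* m (suc n)) ⟩
    - (fromℕ m * fromℕ (suc n))    ≈⟨ -‿distribʳ-* _ _ ⟩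
    fromℕ m * - fromℕ (suc n)      ∎
  fromℤ-* -[1+ m ] (+ n) = begin
    fromℤ (Sign.- ◃ (suc m ℕ.* n)) ≈⟨ fromℤ--◃ (suc m ℕ.* n) ⟩
    - fromℕ (suc m ℕ.* n)          ≈⟨ -‿cong (×1-homo-* (suc m) n) ⟩
    - (fromℕ (suc m) * fromℕ n)    ≈⟨ -‿distribˡ-* _ _ ⟩
    - fromℕ (suc m) * fromℕ n      ∎
  fromℤ-* -[1+ m ] -[1+ n ] = begin
    fromℤ (Sign.+ ◃ (suc m ℕ.* suc n)) ≈⟨ fromℤ-+◃ (suc m ℕ.* suc n) ⟩
    fromℕ (suc m ℕ.* suc n)            ≈⟨ ×1-homo-* (suc m) (suc n) ⟩
    fromℕ (suc m) * fromℕ (suc n)      ≈⟨ *-congʳ (-‿involutive _) ⟨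
    - - fromℕ (suc m) * fromℕ (suc n)  ≈⟨ -‿distribˡ-* _ _ ⟨
    - (- fromℕ (suc m) * fromℕ (suc n)) ≈⟨ -‿distribʳ-* _ _ ⟩
    - fromℕ (suc m) * - fromℕ (suc n)  ∎

module Summations {c ℓ} (R : CommutativeRing c ℓ) where
  open CommutativeRing R
  open import Algebra.Properties.CommutativeSemigroup +-commutativeSemigroup using (interchange)
  open import Relation.Binary.Reasoning.Setoid setoid

  record Summation (I : Set) : Set (c ⊔ ℓ) where
    field
      sum            : (I → Carrier) → Carrier
      sum-cong       : ∀ {f g} → (∀ i → f i ≈ g i) → sum f ≈ sum g
      sum-+          : ∀ f g → sum (λ i → f i + g i) ≈ sum f + sum g
      *-distribˡ-sum : ∀ a f → a * sum f ≈ sum (λ i → a * f i)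

    *-distribʳ-sum : ∀ a f → sum f * a ≈ sum (λ i → f i * a)
    *-distribʳ-sum a f = trans (*-comm _ a) (trans (*-distribˡ-sum a f) (sum-cong (λ i → *-comm a (f i))))

  open Summation

  replaceSum : ∀ {I} (A : Summation I) (s : (I → Carrier) → Carrier) → (∀ f → s f ≡ sum A f) → Summation I
  replaceSum A s s≡ = record
    { sum            = s
    ; sum-cong       = λ {f} {g} f≈g → trans (reflexive (s≡ f))
                                         (trans (sum-cong A f≈g) (reflexive (≡.sym (s≡ g))))
    ; sum-+          = λ f g → trans (reflexive (s≡ _))
                                 (trans (sum-+ A f g) (+-cong (reflexive (≡.sym (s≡ f))) (reflexive (≡.sym (s≡ g)))))
    ; *-distribˡ-sum = λ a f → trans (*-congˡ (reflexive (s≡ f)))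
                                 (trans (*-distribˡ-sum A a f) (reflexive (≡.sym (s≡ _))))
    }

  Interchangeable : ∀ {I} → Summation I → Set (Level.suc Level.zero ⊔ c ⊔ ℓ)
  Interchangeable {I} A = ∀ {J} (B : Summation J) (g : I → J → Carrier) →
    sum A (λ i → sum B (g i)) ≈ sum B (λ j → sum A (λ i → g i j))

  sum₃ : Summation (Fin 3)
  sum₃ = record
    { sum            = λ f → f 0F + (f 1F + f 2F)
    ; sum-cong       = λ f≈g → +-cong (f≈g 0F) (+-cong (f≈g 1F) (f≈g 2F))
    ; sum-+          = λ f g → trans (+-congˡ (interchange (f 1F) (g 1F) (f 2F) (g 2F)))
                                     (interchange (f 0F) (g 0F) _ _)
    ; *-distribˡ-sum = λ a f → trans (distribˡ a (f 0F) _) (+-congˡ (distribˡ a (f 1F) (f 2F)))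
    }

  sum₃-interchangeable : Interchangeable sum₃
  sum₃-interchangeable B g = begin
    sum B (g 0F) + (sum B (g 1F) + sum B (g 2F)) ≈⟨ +-congˡ (sum-+ B (g 1F) (g 2F)) ⟨
    sum B (g 0F) + sum B (λ j → g 1F j + g 2F j) ≈⟨ sum-+ B _ _ ⟨
    sum B (λ j → g 0F j + (g 1F j + g 2F j))     ∎

  replaceSum-interchangeable : ∀ {I} (A : Summation I) s s≡ → Interchangeable A →
                               Interchangeable (replaceSum A s s≡)
  replaceSum-interchangeable A s s≡ A-int B g = begin
    s (λ i → sum B (g i))             ≡⟨ s≡ (λ i → sum B (g i)) ⟩
    sum A (λ i → sum B (g i))         ≈⟨ A-int B g ⟩
    sum B (λ j → sum A (λ i → g i j)) ≈⟨ sum-cong B (λ j → reflexive (s≡ (λ i → g i j))) ⟨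
    sum B (λ j → s (λ i → g i j))     ∎

  infixr 7 _⊗ˢ_
  _⊗ˢ_ : ∀ {I J} → Summation I → Summation J → Summation (I × J)
  A ⊗ˢ B = record
    { sum            = λ f → sum A (λ i → sum B (λ j → f (i , j)))
    ; sum-cong       = λ f≈g → sum-cong A (λ i → sum-cong B (λ j → f≈g (i , j)))
    ; sum-+          = λ f g → trans (sum-cong A (λ i → sum-+ B _ _)) (sum-+ A _ _)
    ; *-distribˡ-sum = λ a f → trans (*-distribˡ-sum A a _) (sum-cong A (λ i → *-distribˡ-sum B a _))
    }

  ⊗ˢ-interchangeable : ∀ {I J} (A : Summation I) (B : Summation J) →
                       Interchangeable A → Interchangeable B → Interchangeable (A ⊗ˢ B)
  ⊗ˢ-interchangeable A B A-int B-int C g = begin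
    sum A (λ i → sum B (λ j → sum C (g (i , j))))            ≈⟨ sum-cong A (λ i → B-int C (λ j → g (i , j))) ⟩
    sum A (λ i → sum C (λ k → sum B (λ j → g (i , j) k)))     ≈⟨ A-int C (λ i k → sum B (λ j → g (i , j) k)) ⟩
    sum C (λ k → sum A (λ i → sum B (λ j → g (i , j) k)))     ∎

⟨$⟩ʳ-injective : ∀ {n} (τ : Permutation′ n) {i j} → τ ⟨$⟩ʳ i ≡ τ ⟨$⟩ʳ j → i ≡ j
⟨$⟩ʳ-injective τ {i} {j} τi≡τj =
  ≡.trans (≡.sym (inverseˡ τ {i})) (≡.trans (≡.cong (τ ⟨$⟩ˡ_) τi≡τj) (inverseˡ τ {j}))

permutation₃-ext : ∀ (σ ρ : Permutation′ 3) → σ ⟨$⟩ʳ 0F ≡ ρ ⟨$⟩ʳ 0F → σ ⟨$⟩ʳ 1F ≡ ρ ⟨$⟩ʳ 1F →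
                   ∀ i → σ ⟨$⟩ʳ i ≡ ρ ⟨$⟩ʳ i
permutation₃-ext σ ρ e₀ e₁ 0F = e₀
permutation₃-ext σ ρ e₀ e₁ 1F = e₁
permutation₃-ext σ ρ e₀ e₁ 2F with σ ⟨$⟩ˡ (ρ ⟨$⟩ʳ 2F) | inverseʳ σ {ρ ⟨$⟩ʳ 2F}
... | 0F | σ0≡ρ2 = contradiction (⟨$⟩ʳ-injective ρ (≡.trans (≡.sym e₀) σ0≡ρ2)) λ ()
... | 1F | σ1≡ρ2 = contradiction (⟨$⟩ʳ-injective ρ (≡.trans (≡.sym e₁) σ1≡ρ2)) λ ()
... | 2F | σ2≡ρ2 = σ2≡ρ2

module Automorphisms {c ℓ} (F : Field c ℓ) where
  open Field F hiding (zero)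
  open Setup F hiding (e11; e12; e13; e21; e22; e23; e31; e32; e33)
  open Summations commutativeRing
  open Summation
  open IntegerCast ring using (fromℤ; fromℤ-+; fromℤ-*; fromℤ-neg)
  open import Algebra.Properties.CommutativeSemigroup *-commutativeSemigroup
    using (x∙yz≈y∙xz; x∙yz≈xz∙y)
  open import Relation.Binary.Reasoning.Setoid setoid

  ≈ᵛ-setoid : Set → Setoid c ℓ
  ≈ᵛ-setoid I = record
    { Carrier       = Vect I
    ; _≈_           = _≈ᵛ_
    ; isEquivalence = record
      { refl  = λ _ → refl
      ; sym   = λ u≈v i → sym (u≈v i)
      ; trans = λ u≈v v≈w i → trans (u≈v i) (v≈w i)
      }
    }

  module ≈ᵛ {I : Set} = Setoid (≈ᵛ-setoid I)

  ≡⇒≈ᵛ : ∀ {I} {u v : Vect I} → u ≡ v → u ≈ᵛ v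
  ≡⇒≈ᵛ ≡.refl = ≈ᵛ.refl

  -- The summations use Setup's Σ₃ and ΣIdx as their sums, and ΣL is opaque, so that the
  -- conversion checker compares sums by name instead of expanding them (ΣL has 729 terms).
  Σ₃ˢ : Summation (Fin 3)
  Σ₃ˢ = record sum₃ { sum = Σ₃ }

  ΣIdxˢ : Summation Idx
  ΣIdxˢ = record (Σ₃ˢ ⊗ˢ Σ₃ˢ) { sum = ΣIdx }

  opaque
    ΣL : (Idx × Idx × Idx → Carrier) → Carrier
    ΣL f = ΣIdx (λ a → ΣIdx (λ b → ΣIdx (λ d → f (a , b , d))))

  opaque
    unfolding ΣL

    ΣL-nested : ∀ f → ΣL f ≡ ΣIdx (λ a → ΣIdx (λ b → ΣIdx (λ d → f (a , b , d))))
    ΣL-nested f = ≡.refl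

  ΣLˢ : Summation (Idx × Idx × Idx)
  ΣLˢ = replaceSum (ΣIdxˢ ⊗ˢ ΣIdxˢ ⊗ˢ ΣIdxˢ) ΣL ΣL-nested

  ΣIdx-interchangeable : Interchangeable ΣIdxˢ
  ΣIdx-interchangeable = ⊗ˢ-interchangeable Σ₃ˢ Σ₃ˢ sum₃-interchangeable sum₃-interchangeable

  ΣL-interchangeable : Interchangeable ΣLˢ
  ΣL-interchangeable = replaceSum-interchangeable (ΣIdxˢ ⊗ˢ ΣIdxˢ ⊗ˢ ΣIdxˢ) ΣL ΣL-nested
    (⊗ˢ-interchangeable ΣIdxˢ (ΣIdxˢ ⊗ˢ ΣIdxˢ) ΣIdx-interchangeable
      (⊗ˢ-interchangeable ΣIdxˢ ΣIdxˢ ΣIdx-interchangeable ΣIdx-interchangeable))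

  kernel-isLinear : ∀ {I J} (S : Summation I) (G : Vect I → Vect J) (K : I → J → Carrier) →
                    (∀ v j → G v j ≈ sum S (λ i → v i * K i j)) → IsLinear G
  kernel-isLinear S G K G≈ = record
    { cong     = λ {u} {v} u≈v j → begin
        G u j                   ≈⟨ G≈ u j ⟩
        sum S (λ i → u i * K i j) ≈⟨ sum-cong S (λ i → *-congʳ {K i j} (u≈v i)) ⟩
        sum S (λ i → v i * K i j) ≈⟨ G≈ v j ⟨
        G v j                   ∎
    ; additive = λ u v j → begin
        G (u +ᵛ v) j                                          ≈⟨ G≈ (u +ᵛ v) j ⟩
        sum S (λ i → (u i + v i) * K i j)                     ≈⟨ sum-cong S (λ i → distribʳ (K i j) (u i) (v i)) ⟩
        sum S (λ i → u i * K i j + v i * K i j)               ≈⟨ sum-+ S (λ i → u i * K i j) (λ i → v i * K i j) ⟩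
        sum S (λ i → u i * K i j) + sum S (λ i → v i * K i j) ≈⟨ +-cong (G≈ u j) (G≈ v j) ⟨
        G u j + G v j                                         ∎
    ; homog    = λ a v j → begin
        G (a ·ᵛ v) j                ≈⟨ G≈ (a ·ᵛ v) j ⟩
        sum S (λ i → a * v i * K i j) ≈⟨ sum-cong S (λ i → *-assoc a (v i) (K i j)) ⟩
        sum S (λ i → a * (v i * K i j)) ≈⟨ *-distribˡ-sum S a (λ i → v i * K i j) ⟨
        a * sum S (λ i → v i * K i j)   ≈⟨ *-congˡ (G≈ v j) ⟨
        a * G v j                     ∎
    }

  -- Matrix units and maps determined by their values on them

  unit : Idx → M
  unit a = E (proj₁ a) (proj₂ a)

  δ-sift : ∀ (f : Fin 3 → Carrier) j → Σ₃ (λ k → f k * δ k j) ≈ f j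
  δ-sift f 0F =
    trans (+-cong (*-identityʳ _) (trans (+-cong (zeroʳ _) (zeroʳ _)) (+-identityˡ 0#))) (+-identityʳ _)
  δ-sift f 1F =
    trans (+-cong (zeroʳ _) (trans (+-congʳ (*-identityʳ _)) (trans (+-congˡ (zeroʳ _)) (+-identityʳ _))))
          (+-identityˡ _)
  δ-sift f 2F =
    trans (+-cong (zeroʳ _) (trans (+-cong (zeroʳ _) (*-identityʳ _)) (+-identityˡ _))) (+-identityˡ _)

  unit-expansion : ∀ (x : M) p → x p ≈ ΣIdx (λ a → x a * unit a p)
  unit-expansion x (p₁ , p₂) = sym (begin
    Σ₃ (λ i → Σ₃ (λ j → x (i , j) * (δ i p₁ * δ j p₂)))
      ≈⟨ sum-cong Σ₃ˢ (λ i → sum-cong Σ₃ˢ (λ j → x∙yz≈xz∙y (x (i , j)) (δ i p₁) (δ j p₂))) ⟩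
    Σ₃ (λ i → Σ₃ (λ j → x (i , j) * δ j p₂ * δ i p₁))
      ≈⟨ sum-cong Σ₃ˢ (λ i → *-distribʳ-sum Σ₃ˢ (δ i p₁) (λ j → x (i , j) * δ j p₂)) ⟨
    Σ₃ (λ i → Σ₃ (λ j → x (i , j) * δ j p₂) * δ i p₁)
      ≈⟨ sum-cong Σ₃ˢ (λ i → *-congʳ {δ i p₁} (δ-sift (λ j → x (i , j)) p₂)) ⟩
    Σ₃ (λ i → x (i , p₂) * δ i p₁)
      ≈⟨ δ-sift (λ i → x (i , p₂)) p₁ ⟩
    x (p₁ , p₂) ∎)

  BasisLinear : (M → M) → Set (c ⊔ ℓ)
  BasisLinear G = ∀ x p → G x p ≈ ΣIdx (λ a → x a * G (unit a) p)

  basisLinear-ᵗ : BasisLinear _ᵗ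
  basisLinear-ᵗ x (i , j) = unit-expansion x (j , i)

  basisLinear-·ₘˡ : ∀ C → BasisLinear (C ·ₘ_)
  basisLinear-·ₘˡ C x (i , j) = begin
    Σ₃ (λ k → C (i , k) * x (k , j))
      ≈⟨ sum-cong Σ₃ˢ (λ k → *-congˡ {C (i , k)} (unit-expansion x (k , j))) ⟩
    Σ₃ (λ k → C (i , k) * ΣIdx (λ a → x a * unit a (k , j)))
      ≈⟨ sum-cong Σ₃ˢ (λ k → *-distribˡ-sum ΣIdxˢ (C (i , k)) (λ a → x a * unit a (k , j))) ⟩
    Σ₃ (λ k → ΣIdx (λ a → C (i , k) * (x a * unit a (k , j))))
      ≈⟨ sum₃-interchangeable ΣIdxˢ (λ k a → C (i , k) * (x a * unit a (k , j))) ⟩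
    ΣIdx (λ a → Σ₃ (λ k → C (i , k) * (x a * unit a (k , j))))
      ≈⟨ sum-cong ΣIdxˢ (λ a → sum-cong Σ₃ˢ (λ k → x∙yz≈y∙xz (C (i , k)) (x a) (unit a (k , j)))) ⟩
    ΣIdx (λ a → Σ₃ (λ k → x a * (C (i , k) * unit a (k , j))))
      ≈⟨ sum-cong ΣIdxˢ (λ a → *-distribˡ-sum Σ₃ˢ (x a) (λ k → C (i , k) * unit a (k , j))) ⟨
    ΣIdx (λ a → x a * Σ₃ (λ k → C (i , k) * unit a (k , j))) ∎

  basisLinear-·ₘʳ : ∀ C → BasisLinear (_·ₘ C)
  basisLinear-·ₘʳ C x (i , j) = begin
    Σ₃ (λ k → x (i , k) * C (k , j))
      ≈⟨ sum-cong Σ₃ˢ (λ k → *-congʳ {C (k , j)} (unit-expansion x (i , k))) ⟩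
    Σ₃ (λ k → ΣIdx (λ a → x a * unit a (i , k)) * C (k , j))
      ≈⟨ sum-cong Σ₃ˢ (λ k → *-distribʳ-sum ΣIdxˢ (C (k , j)) (λ a → x a * unit a (i , k))) ⟩
    Σ₃ (λ k → ΣIdx (λ a → x a * unit a (i , k) * C (k , j)))
      ≈⟨ sum₃-interchangeable ΣIdxˢ (λ k a → x a * unit a (i , k) * C (k , j)) ⟩
    ΣIdx (λ a → Σ₃ (λ k → x a * unit a (i , k) * C (k , j)))
      ≈⟨ sum-cong ΣIdxˢ (λ a → sum-cong Σ₃ˢ (λ k → *-assoc (x a) (unit a (i , k)) (C (k , j)))) ⟩
    ΣIdx (λ a → Σ₃ (λ k → x a * (unit a (i , k) * C (k , j))))
      ≈⟨ sum-cong ΣIdxˢ (λ a → *-distribˡ-sum Σ₃ˢ (x a) (λ k → unit a (i , k) * C (k , j))) ⟨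
    ΣIdx (λ a → x a * Σ₃ (λ k → unit a (i , k) * C (k , j))) ∎

  basisLinear-∘ : ∀ {G H} → BasisLinear G → BasisLinear H → BasisLinear (G ∘ H)
  basisLinear-∘ {G} {H} G-lin H-lin x p = begin
    G (H x) p
      ≈⟨ G-lin (H x) p ⟩
    ΣIdx (λ b → H x b * G (unit b) p)
      ≈⟨ sum-cong ΣIdxˢ (λ b → *-congʳ {G (unit b) p} (H-lin x b)) ⟩
    ΣIdx (λ b → ΣIdx (λ a → x a * H (unit a) b) * G (unit b) p)
      ≈⟨ sum-cong ΣIdxˢ (λ b → *-distribʳ-sum ΣIdxˢ (G (unit b) p) (λ a → x a * H (unit a) b)) ⟩
    ΣIdx (λ b → ΣIdx (λ a → x a * H (unit a) b * G (unit b) p))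
      ≈⟨ ΣIdx-interchangeable ΣIdxˢ (λ b a → x a * H (unit a) b * G (unit b) p) ⟩
    ΣIdx (λ a → ΣIdx (λ b → x a * H (unit a) b * G (unit b) p))
      ≈⟨ sum-cong ΣIdxˢ (λ a → sum-cong ΣIdxˢ (λ b → *-assoc (x a) (H (unit a) b) (G (unit b) p))) ⟩
    ΣIdx (λ a → ΣIdx (λ b → x a * (H (unit a) b * G (unit b) p)))
      ≈⟨ sum-cong ΣIdxˢ (λ a → *-distribˡ-sum ΣIdxˢ (x a) (λ b → H (unit a) b * G (unit b) p)) ⟨
    ΣIdx (λ a → x a * ΣIdx (λ b → H (unit a) b * G (unit b) p))
      ≈⟨ sum-cong ΣIdxˢ (λ a → *-congˡ {x a} (G-lin (H (unit a)) p)) ⟨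
    ΣIdx (λ a → x a * G (H (unit a)) p) ∎

  basisLinear⇒isLinear : ∀ {G} → BasisLinear G → IsLinear G
  basisLinear⇒isLinear {G} G-lin = kernel-isLinear ΣIdxˢ G (λ a → G (unit a)) G-lin

  basisLinear⇒isLinIso : ∀ {G H} → BasisLinear G → BasisLinear H →
                         (∀ a → H (G (unit a)) ≈ᵛ unit a) → (∀ a → G (H (unit a)) ≈ᵛ unit a) →
                         IsLinIso G
  basisLinear⇒isLinIso {G} {H} G-lin H-lin HG GH = record
    { linear   = basisLinear⇒isLinear G-lin
    ; inv      = H
    ; inv-cong = IsLinear.cong (basisLinear⇒isLinear H-lin)
    ; inv-l    = λ v p → trans (basisLinear-∘ H-lin G-lin v p)
                           (trans (sum-cong ΣIdxˢ (λ a → *-congˡ {v a} (HG a p))) (sym (unit-expansion v p)))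
    ; inv-r    = λ v p → trans (basisLinear-∘ G-lin H-lin v p)
                           (trans (sum-cong ΣIdxˢ (λ a → *-congˡ {v a} (GH a p))) (sym (unit-expansion v p)))
    }

  -- Tensors and the linear extension of trilinear maps

  ⊗-cong : ∀ {x x′ y y′ z z′} → x ≈ᵛ x′ → y ≈ᵛ y′ → z ≈ᵛ z′ → (x ⊗ y ⊗ z) ≈L (x′ ⊗ y′ ⊗ z′)
  ⊗-cong x≈ y≈ z≈ (p , q , r) = *-cong (*-cong (x≈ p) (y≈ q)) (z≈ r)

  ⊗ᶠ-cong : ∀ {u v : Fin 3 → M} → (∀ k → u k ≈ᵛ v k) → ⊗ᶠ u ≈L ⊗ᶠ v
  ⊗ᶠ-cong u≈v = ⊗-cong (u≈v 0F) (u≈v 1F) (u≈v 2F)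

  ⊗-basisLinear₁ : ∀ {G} → BasisLinear G → ∀ x B C w →
                   (G x ⊗ B ⊗ C) w ≈ ΣIdx (λ a → x a * (G (unit a) ⊗ B ⊗ C) w)
  ⊗-basisLinear₁ {G} G-lin x B C (p , q , r) = begin
    G x p * B q * C r
      ≈⟨ *-congʳ {C r} (*-congʳ {B q} (G-lin x p)) ⟩
    ΣIdx (λ a → x a * G (unit a) p) * B q * C r
      ≈⟨ *-congʳ {C r} (*-distribʳ-sum ΣIdxˢ (B q) (λ a → x a * G (unit a) p)) ⟩
    ΣIdx (λ a → x a * G (unit a) p * B q) * C r
      ≈⟨ *-distribʳ-sum ΣIdxˢ (C r) (λ a → x a * G (unit a) p * B q) ⟩
    ΣIdx (λ a → x a * G (unit a) p * B q * C r)
      ≈⟨ sum-cong ΣIdxˢ (λ a → trans (*-congʳ {C r} (*-assoc (x a) (G (unit a) p) (B q)))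
                                     (*-assoc (x a) (G (unit a) p * B q) (C r))) ⟩
    ΣIdx (λ a → x a * (G (unit a) p * B q * C r)) ∎

  ⊗-basisLinear₂ : ∀ {G} → BasisLinear G → ∀ A x C w →
                   (A ⊗ G x ⊗ C) w ≈ ΣIdx (λ a → x a * (A ⊗ G (unit a) ⊗ C) w)
  ⊗-basisLinear₂ {G} G-lin A x C (p , q , r) = begin
    A p * G x q * C r
      ≈⟨ *-congʳ {C r} (*-congˡ {A p} (G-lin x q)) ⟩
    A p * ΣIdx (λ a → x a * G (unit a) q) * C r
      ≈⟨ *-congʳ {C r} (*-distribˡ-sum ΣIdxˢ (A p) (λ a → x a * G (unit a) q)) ⟩
    ΣIdx (λ a → A p * (x a * G (unit a) q)) * C r
      ≈⟨ *-distribʳ-sum ΣIdxˢ (C r) (λ a → A p * (x a * G (unit a) q)) ⟩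
    ΣIdx (λ a → A p * (x a * G (unit a) q) * C r)
      ≈⟨ sum-cong ΣIdxˢ (λ a → trans (*-congʳ {C r} (x∙yz≈y∙xz (A p) (x a) (G (unit a) q)))
                                     (*-assoc (x a) (A p * G (unit a) q) (C r))) ⟩
    ΣIdx (λ a → x a * (A p * G (unit a) q * C r)) ∎

  ⊗-basisLinear₃ : ∀ {G} → BasisLinear G → ∀ A B x w →
                   (A ⊗ B ⊗ G x) w ≈ ΣIdx (λ a → x a * (A ⊗ B ⊗ G (unit a)) w)
  ⊗-basisLinear₃ {G} G-lin A B x (p , q , r) = begin
    A p * B q * G x r
      ≈⟨ *-congˡ {A p * B q} (G-lin x r) ⟩
    A p * B q * ΣIdx (λ a → x a * G (unit a) r)
      ≈⟨ *-distribˡ-sum ΣIdxˢ (A p * B q) (λ a → x a * G (unit a) r) ⟩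
    ΣIdx (λ a → A p * B q * (x a * G (unit a) r))
      ≈⟨ sum-cong ΣIdxˢ (λ a → x∙yz≈y∙xz (A p * B q) (x a) (G (unit a) r)) ⟩
    ΣIdx (λ a → x a * (A p * B q * G (unit a) r)) ∎

  record TriBasisLinear (f : M → M → M → L) : Set (c ⊔ ℓ) where
    field
      linear₁ : ∀ x y z w → f x y z w ≈ ΣIdx (λ a → x a * f (unit a) y z w)
      linear₂ : ∀ x y z w → f x y z w ≈ ΣIdx (λ b → y b * f x (unit b) z w)
      linear₃ : ∀ x y z w → f x y z w ≈ ΣIdx (λ d → z d * f x y (unit d) w)

  linExt-⊗ : ∀ {f} → TriBasisLinear f → ∀ x y z → linExt f (x ⊗ y ⊗ z) ≈L f x y z
  linExt-⊗ {f} f-lin x y z w = sym (begin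
    f x y z w
      ≈⟨ linear₁ x y z w ⟩
    ΣIdx (λ a → x a * f (unit a) y z w)
      ≈⟨ sum-cong ΣIdxˢ (λ a → *-congˡ {x a} (trans (linear₂ (unit a) y z w)
           (sum-cong ΣIdxˢ (λ b → *-congˡ {y b} (linear₃ (unit a) (unit b) z w))))) ⟩
    ΣIdx (λ a → x a * ΣIdx (λ b → y b * ΣIdx (λ d → z d * f′ a b d)))
      ≈⟨ sum-cong ΣIdxˢ (λ a → trans (*-congˡ {x a} (sum-cong ΣIdxˢ (λ b →
           *-distribˡ-sum ΣIdxˢ (y b) (λ d → z d * f′ a b d))))
           (*-distribˡ-sum ΣIdxˢ (x a) (λ b → ΣIdx (λ d → y b * (z d * f′ a b d))))) ⟩
    ΣIdx (λ a → ΣIdx (λ b → x a * ΣIdx (λ d → y b * (z d * f′ a b d))))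
      ≈⟨ sum-cong ΣIdxˢ (λ a → sum-cong ΣIdxˢ (λ b →
           *-distribˡ-sum ΣIdxˢ (x a) (λ d → y b * (z d * f′ a b d)))) ⟩
    ΣIdx (λ a → ΣIdx (λ b → ΣIdx (λ d → x a * (y b * (z d * f′ a b d)))))
      ≈⟨ sum-cong ΣIdxˢ (λ a → sum-cong ΣIdxˢ (λ b → sum-cong ΣIdxˢ (λ d →
           reassoc (x a) (y b) (z d) (f′ a b d)))) ⟩
    linExt f (x ⊗ y ⊗ z) w ∎)
    where
    open TriBasisLinear f-lin
    f′ : Idx → Idx → Idx → Carrier
    f′ a b d = f (unit a) (unit b) (unit d) w
    reassoc : ∀ a b d e → a * (b * (d * e)) ≈ a * b * d * e
    reassoc a b d e = trans (sym (*-assoc a b (d * e))) (sym (*-assoc (a * b) d e))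

  unitTensor : Idx × Idx × Idx → L
  unitTensor (a , b , d) = unit a ⊗ unit b ⊗ unit d

  linExt-kernel : (M → M → M → L) → Idx × Idx × Idx → L
  linExt-kernel f (a , b , d) = f (unit a) (unit b) (unit d)

  linExt-ΣL : ∀ f T w → linExt f T w ≡ ΣL (λ q → T q * linExt-kernel f q w)
  linExt-ΣL f T w = ≡.sym (ΣL-nested (λ q → T q * linExt-kernel f q w))

  linExt-isLinear : ∀ f → IsLinear (linExt f)
  linExt-isLinear f = kernel-isLinear ΣLˢ (linExt f) (linExt-kernel f) (λ T w → reflexive (linExt-ΣL f T w))

  unitTensor-expansion : ∀ (T : L) w → T w ≈ ΣL (λ q → T q * unitTensor q w)
  unitTensor-expansion T (w₁ , w₂ , w₃) = begin
    T (w₁ , w₂ , w₃)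
      ≈⟨ unit-expansion (λ a → T (a , w₂ , w₃)) w₁ ⟩
    ΣIdx (λ a → T (a , w₂ , w₃) * u₁ a)
      ≈⟨ sum-cong ΣIdxˢ (λ a → *-congʳ {u₁ a} (unit-expansion (λ b → T (a , b , w₃)) w₂)) ⟩
    ΣIdx (λ a → ΣIdx (λ b → T (a , b , w₃) * u₂ b) * u₁ a)
      ≈⟨ sum-cong ΣIdxˢ (λ a → *-congʳ {u₁ a} (sum-cong ΣIdxˢ (λ b →
           *-congʳ {u₂ b} (unit-expansion (λ d → T (a , b , d)) w₃)))) ⟩
    ΣIdx (λ a → ΣIdx (λ b → ΣIdx (λ d → T (a , b , d) * u₃ d) * u₂ b) * u₁ a)
      ≈⟨ sum-cong ΣIdxˢ (λ a → trans
           (*-distribʳ-sum ΣIdxˢ (u₁ a) (λ b → ΣIdx (λ d → T (a , b , d) * u₃ d) * u₂ b))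
           (sum-cong ΣIdxˢ (λ b → trans
             (*-congʳ {u₁ a} (*-distribʳ-sum ΣIdxˢ (u₂ b) (λ d → T (a , b , d) * u₃ d)))
             (*-distribʳ-sum ΣIdxˢ (u₁ a) (λ d → T (a , b , d) * u₃ d * u₂ b))))) ⟩
    ΣIdx (λ a → ΣIdx (λ b → ΣIdx (λ d → T (a , b , d) * u₃ d * u₂ b * u₁ a)))
      ≈⟨ sum-cong ΣIdxˢ (λ a → sum-cong ΣIdxˢ (λ b → sum-cong ΣIdxˢ (λ d →
           reorder (T (a , b , d)) (u₃ d) (u₂ b) (u₁ a)))) ⟩
    ΣIdx (λ a → ΣIdx (λ b → ΣIdx (λ d → T (a , b , d) * unitTensor (a , b , d) (w₁ , w₂ , w₃))))
      ≡⟨ ΣL-nested (λ q → T q * unitTensor q (w₁ , w₂ , w₃)) ⟨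
    ΣL (λ q → T q * unitTensor q (w₁ , w₂ , w₃)) ∎
    where
    u₁ u₂ u₃ : Idx → Carrier
    u₁ a = unit a w₁
    u₂ b = unit b w₂
    u₃ d = unit d w₃
    reorder : ∀ t d b a → t * d * b * a ≈ t * (a * b * d)
    reorder t d b a = begin
      t * d * b * a     ≈⟨ *-assoc (t * d) b a ⟩
      t * d * (b * a)   ≈⟨ *-assoc t d (b * a) ⟩
      t * (d * (b * a)) ≈⟨ *-congˡ {t} (trans (*-comm d (b * a)) (*-congʳ {d} (*-comm b a))) ⟩
      t * (a * b * d)   ∎

  linExt-inverse : ∀ f g → (∀ q → linExt g (linExt-kernel f q) ≈L unitTensor q) →
                   ∀ T → linExt g (linExt f T) ≈L T
  linExt-inverse f g gf T w = begin
    linExt g (linExt f T) w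
      ≡⟨ linExt-ΣL g (linExt f T) w ⟩
    ΣL (λ q → linExt f T q * Kg q)
      ≈⟨ sum-cong ΣLˢ (λ q → *-congʳ {Kg q} (reflexive (linExt-ΣL f T q))) ⟩
    ΣL (λ q → ΣL (λ p → T p * Kf p q) * Kg q)
      ≈⟨ sum-cong ΣLˢ (λ q → *-distribʳ-sum ΣLˢ (Kg q) (λ p → T p * Kf p q)) ⟩
    ΣL (λ q → ΣL (λ p → T p * Kf p q * Kg q))
      ≈⟨ ΣL-interchangeable ΣLˢ (λ q p → T p * Kf p q * Kg q) ⟩
    ΣL (λ p → ΣL (λ q → T p * Kf p q * Kg q))
      ≈⟨ sum-cong ΣLˢ (λ p → trans (sum-cong ΣLˢ (λ q → *-assoc (T p) (Kf p q) (Kg q)))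
                                   (sym (*-distribˡ-sum ΣLˢ (T p) (λ q → Kf p q * Kg q)))) ⟩
    ΣL (λ p → T p * ΣL (λ q → Kf p q * Kg q))
      ≈⟨ sum-cong ΣLˢ (λ p → *-congˡ {T p} (trans (reflexive (≡.sym (linExt-ΣL g (linExt-kernel f p) w))) (gf p w))) ⟩
    ΣL (λ p → T p * unitTensor p w)
      ≈⟨ unitTensor-expansion T w ⟨
    T w ∎
    where
    Kf : Idx × Idx × Idx → Idx × Idx × Idx → Carrier
    Kf p = linExt-kernel f p
    Kg : Idx × Idx × Idx → Carrier
    Kg q = linExt-kernel g q w

  -- Closure of Aut(𝓛) under the group operations

  module _ {I J : Set} where
    isLinIso-inverse : ∀ {f : Vect I → Vect J} {h} → IsLinIso f →
      (∀ {u v} → u ≈ᵛ v → h u ≈ᵛ h v) → (∀ w → f (h w) ≈ᵛ w) → (∀ v → h (f v) ≈ᵛ v) → IsLinIso h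
    isLinIso-inverse {f} {h} f-iso h-cong fh hf = record
      { linear   = record
        { cong     = h-cong
        ; additive = λ u v → ≈ᵛ.trans
            (h-cong (≈ᵛ.trans (λ j → +-cong (sym (fh u j)) (sym (fh v j))) (≈ᵛ.sym (F.additive (h u) (h v)))))
            (hf (h u +ᵛ h v))
        ; homog    = λ a v → ≈ᵛ.trans
            (h-cong (≈ᵛ.trans (λ j → *-congˡ (sym (fh v j))) (≈ᵛ.sym (F.homog a (h v)))))
            (hf (a ·ᵛ h v))
        }
      ; inv      = f
      ; inv-cong = F.cong
      ; inv-l    = fh
      ; inv-r    = hf
      }
      where module F = IsLinear (IsLinIso.linear f-iso)

    isLinIso-resp : ∀ {f h : Vect I → Vect J} → IsLinIso f → (∀ v → f v ≈ᵛ h v) → IsLinIso h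
    isLinIso-resp f-iso f≈h = record
      { linear   = record
        { cong     = λ {u} {v} u≈v → ≈ᵛ.trans (≈ᵛ.sym (f≈h u)) (≈ᵛ.trans (F.cong u≈v) (f≈h v))
        ; additive = λ u v → ≈ᵛ.trans (≈ᵛ.sym (f≈h (u +ᵛ v)))
                               (≈ᵛ.trans (F.additive u v) (λ j → +-cong (f≈h u j) (f≈h v j)))
        ; homog    = λ a v → ≈ᵛ.trans (≈ᵛ.sym (f≈h (a ·ᵛ v)))
                               (≈ᵛ.trans (F.homog a v) (λ j → *-congˡ (f≈h v j)))
        }
      ; inv      = f⁻¹.inv
      ; inv-cong = f⁻¹.inv-cong
      ; inv-l    = λ v → ≈ᵛ.trans (f⁻¹.inv-cong (≈ᵛ.sym (f≈h v))) (f⁻¹.inv-l v)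
      ; inv-r    = λ w → ≈ᵛ.trans (≈ᵛ.sym (f≈h (f⁻¹.inv w))) (f⁻¹.inv-r w)
      }
      where
      module F = IsLinear (IsLinIso.linear f-iso)
      module f⁻¹ = IsLinIso f-iso

  isLinIso-id : ∀ {I} → IsLinIso {I} id
  isLinIso-id = record
    { linear   = record { cong = id ; additive = λ _ _ → ≈ᵛ.refl ; homog = λ _ _ → ≈ᵛ.refl }
    ; inv      = id
    ; inv-cong = id
    ; inv-l    = λ _ → ≈ᵛ.refl
    ; inv-r    = λ _ → ≈ᵛ.refl
    }

  isLinIso-∘ : ∀ {I J K} {g : Vect J → Vect K} {h : Vect I → Vect J} →
               IsLinIso g → IsLinIso h → IsLinIso (g ∘ h)
  isLinIso-∘ {h = h} g-iso h-iso = record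
    { linear   = record
      { cong     = G.cong ∘ H.cong
      ; additive = λ u v → ≈ᵛ.trans (G.cong (H.additive u v)) (G.additive (h u) (h v))
      ; homog    = λ a v → ≈ᵛ.trans (G.cong (H.homog a v)) (G.homog a (h v))
      }
    ; inv      = h⁻¹.inv ∘ g⁻¹.inv
    ; inv-cong = h⁻¹.inv-cong ∘ g⁻¹.inv-cong
    ; inv-l    = λ v → ≈ᵛ.trans (h⁻¹.inv-cong (g⁻¹.inv-l (h v))) (h⁻¹.inv-l v)
    ; inv-r    = λ w → ≈ᵛ.trans (G.cong (h⁻¹.inv-r (g⁻¹.inv w))) (g⁻¹.inv-r w)
    }
    where
    module G = IsLinear (IsLinIso.linear g-iso)
    module H = IsLinear (IsLinIso.linear h-iso)
    module g⁻¹ = IsLinIso g-iso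
    module h⁻¹ = IsLinIso h-iso

  decomposition-id : Decomposition id
  decomposition-id = record
    { τ = Perm.id ; φ = λ _ → id ; φ-iso = λ _ → isLinIso-id ; action = λ _ → ≈ᵛ.refl }

  decomposition-∘ : ∀ {g h : L → L} → IsLinIso g → Decomposition g → Decomposition h →
                    Decomposition (g ∘ h)
  decomposition-∘ g-iso g-dec h-dec = record
    { τ      = H.τ ∘ₚ G.τ
    ; φ      = λ i → G.φ (H.τ ⟨$⟩ʳ i) ∘ H.φ i
    ; φ-iso  = λ i → isLinIso-∘ (G.φ-iso (H.τ ⟨$⟩ʳ i)) (H.φ-iso i)
    ; action = λ u → ≈ᵛ.trans (IsLinear.cong (IsLinIso.linear g-iso) (H.action u))
        (≈ᵛ.trans (G.action (λ k → H.φ (H.τ ⟨$⟩ˡ k) (u (H.τ ⟨$⟩ˡ k))))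
          (⊗ᶠ-cong (λ k → ≡⇒≈ᵛ (≡.cong (λ j → G.φ j (H.φ (H.τ ⟨$⟩ˡ (G.τ ⟨$⟩ˡ k)) (u (H.τ ⟨$⟩ˡ (G.τ ⟨$⟩ˡ k)))))
                                       (≡.sym (inverseʳ H.τ {G.τ ⟨$⟩ˡ k}))))))
    }
    where
    module G = Decomposition g-dec
    module H = Decomposition h-dec

  decomposition-inverse : ∀ {f h : L → L} → Decomposition f → (∀ {u v} → u ≈L v → h u ≈L h v) →
                          (∀ T → h (f T) ≈L T) → Decomposition h
  decomposition-inverse {f} f-dec h-cong hf = record
    { τ      = flip D.τ
    ; φ      = λ i → φ⁻¹ (D.τ ⟨$⟩ˡ i)
    ; φ-iso  = λ i → let module φ⁻¹ = IsLinIso (D.φ-iso (D.τ ⟨$⟩ˡ i)) in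
                     isLinIso-inverse (D.φ-iso (D.τ ⟨$⟩ˡ i)) φ⁻¹.inv-cong φ⁻¹.inv-r φ⁻¹.inv-l
    ; action = λ u → ≈ᵛ.trans (h-cong (≈ᵛ.sym (f-pre u))) (≈ᵛ.trans (hf (⊗ᶠ (pre u)))
        (⊗ᶠ-cong (λ k → ≡⇒≈ᵛ (≡.cong (λ i → φ⁻¹ i (u (D.τ ⟨$⟩ʳ k))) (≡.sym (inverseˡ D.τ {k}))))))
    }
    where
    module D = Decomposition f-dec
    φ⁻¹ : Fin 3 → M → M
    φ⁻¹ j = IsLinIso.inv (D.φ-iso j)
    pre : (Fin 3 → M) → Fin 3 → M
    pre u k = φ⁻¹ k (u (D.τ ⟨$⟩ʳ k))
    f-pre : ∀ u → f (⊗ᶠ (pre u)) ≈L ⊗ᶠ u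
    f-pre u = ≈ᵛ.trans (D.action (pre u)) (⊗ᶠ-cong (λ k →
      ≈ᵛ.trans (IsLinIso.inv-r (D.φ-iso (D.τ ⟨$⟩ˡ k)) (u (D.τ ⟨$⟩ʳ (D.τ ⟨$⟩ˡ k))))
               (≡⇒≈ᵛ (≡.cong u (inverseʳ D.τ {k})))))

  decomposition-resp : ∀ {f h : L → L} → Decomposition f → (∀ T → f T ≈L h T) → Decomposition h
  decomposition-resp f-dec f≈h = record
    { τ = D.τ ; φ = D.φ ; φ-iso = D.φ-iso
    ; action = λ u → ≈ᵛ.trans (≈ᵛ.sym (f≈h (⊗ᶠ u))) (D.action u) }
    where module D = Decomposition f-dec

  Preserves : List L → (L → L) → Set (c ⊔ ℓ)
  Preserves xs g = All (λ t → Any (λ s → g t ≈L s) xs) xs × All (λ t → Any (λ s → g s ≈L t) xs) xs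

  preserves-id : ∀ xs → Preserves xs id
  preserves-id xs = All.tabulate (λ t∈ → Any.map (λ { ≡.refl → ≈ᵛ.refl }) t∈)
                  , All.tabulate (λ t∈ → Any.map (λ { ≡.refl → ≈ᵛ.refl }) t∈)

  preserves-∘ : ∀ {xs} {g h : L → L} → (∀ {u v} → u ≈L v → g u ≈L g v) →
                Preserves xs g → Preserves xs h → Preserves xs (g ∘ h)
  preserves-∘ g-cong (g-into , g-onto) (h-into , h-onto) =
    All.map (All.lookupWith (λ gs∈ ht≈s → Any.map (≈ᵛ.trans (g-cong ht≈s)) gs∈) g-into) h-into ,
    All.map (All.lookupWith (λ hr∈ gs≈t → Any.map (λ hr≈s → ≈ᵛ.trans (g-cong hr≈s) gs≈t) hr∈) h-onto) g-onto

  preserves-inverse : ∀ {xs} {f h : L → L} → Preserves xs f → (∀ {u v} → u ≈L v → h u ≈L h v) →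
                      (∀ T → h (f T) ≈L T) → Preserves xs h
  preserves-inverse (f-into , f-onto) h-cong hf =
    All.map (Any.map (λ {s} fs≈t → ≈ᵛ.trans (h-cong (≈ᵛ.sym fs≈t)) (hf s))) f-onto ,
    All.map (Any.map (λ {s} ft≈s → ≈ᵛ.trans (h-cong (≈ᵛ.sym ft≈s)) (hf _))) f-into

  preserves-resp : ∀ {xs} {f h : L → L} → Preserves xs f → (∀ T → f T ≈L h T) → Preserves xs h
  preserves-resp (f-into , f-onto) f≈h =
    All.map (λ {t} → Any.map (≈ᵛ.trans (≈ᵛ.sym (f≈h t)))) f-into ,
    All.map (Any.map (λ {s} → ≈ᵛ.trans (≈ᵛ.sym (f≈h s)))) f-onto

  preserves-tabulate : ∀ {n} (t : Fin n → L) {g} (σ ρ : Fin n → Fin n) →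
    (∀ i → g (t i) ≈L t (σ i)) → (∀ j → σ (ρ j) ≡ j) → Preserves (List.tabulate t) g
  preserves-tabulate t σ ρ gt σρ =
    All.tabulate⁺ (λ i → Any.tabulate⁺ (σ i) (gt i)) ,
    All.tabulate⁺ (λ j → Any.tabulate⁺ (ρ j) (≈ᵛ.trans (gt (ρ j)) (≡⇒≈ᵛ (≡.cong t (σρ j)))))

  aut-id : InAut𝓛 id
  aut-id = (isLinIso-id , decomposition-id) , preserves-id Laderman

  aut-∘ : ∀ {g h} → InAut𝓛 g → InAut𝓛 h → InAut𝓛 (g ∘ h)
  aut-∘ ((g-iso , g-dec) , g-pres) ((h-iso , h-dec) , h-pres) =
    (isLinIso-∘ g-iso h-iso , decomposition-∘ g-iso g-dec h-dec) ,
    preserves-∘ (IsLinear.cong (IsLinIso.linear g-iso)) g-pres h-pres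

  aut-inverse : ∀ {f h} → InAut𝓛 f → (∀ {u v} → u ≈L v → h u ≈L h v) →
                (∀ T → f (h T) ≈L T) → (∀ T → h (f T) ≈L T) → InAut𝓛 h
  aut-inverse ((f-iso , f-dec) , f-pres) h-cong fh hf =
    (isLinIso-inverse f-iso h-cong fh hf , decomposition-inverse f-dec h-cong hf) ,
    preserves-inverse f-pres h-cong hf

  aut-resp : ∀ {f h} → InAut𝓛 f → (∀ T → f T ≈L h T) → InAut𝓛 h
  aut-resp ((f-iso , f-dec) , f-pres) f≈h =
    (isLinIso-resp f-iso f≈h , decomposition-resp f-dec f≈h) , preserves-resp f-pres f≈h

  -- Decomposable automorphisms induced by a permutation of the factors

  permutedTensor : Permutation′ 3 → (Fin 3 → M → M) → M → M → M → L
  permutedTensor τ φ x y z = ⊗ᶠ (λ k → φ (τ ⟨$⟩ˡ k) ((x ∷ y ∷ z ∷ []) (τ ⟨$⟩ˡ k)))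

  PermutedTensorTriLinear : Permutation′ 3 → Set (c ⊔ ℓ)
  PermutedTensorTriLinear τ = ∀ {φ} → (∀ i → BasisLinear (φ i)) → TriBasisLinear (permutedTensor τ φ)

  ∷-η : ∀ {A : Set c} (u : Fin 3 → A) k → (u 0F ∷ u 1F ∷ u 2F ∷ []) k ≡ u k
  ∷-η u 0F = ≡.refl
  ∷-η u 1F = ≡.refl
  ∷-η u 2F = ≡.refl

  permutedTensor-action : ∀ τ φ → TriBasisLinear (permutedTensor τ φ) → ∀ u →
    linExt (permutedTensor τ φ) (⊗ᶠ u) ≈L ⊗ᶠ (λ k → φ (τ ⟨$⟩ˡ k) (u (τ ⟨$⟩ˡ k)))
  permutedTensor-action τ φ f-lin u = ≈ᵛ.trans (linExt-⊗ f-lin (u 0F) (u 1F) (u 2F))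
    (⊗ᶠ-cong (λ k → ≡⇒≈ᵛ (≡.cong (φ (τ ⟨$⟩ˡ k)) (∷-η u (τ ⟨$⟩ˡ k)))))

  record FactorInverses (φ ψ : Fin 3 → M → M) : Set (c ⊔ ℓ) where
    field
      φ-linear : ∀ i → BasisLinear (φ i)
      ψ-linear : ∀ i → BasisLinear (ψ i)
      ψ∘φ      : ∀ i a → ψ i (φ i (unit a)) ≈ᵛ unit a
      φ∘ψ      : ∀ i a → φ i (ψ i (unit a)) ≈ᵛ unit a

  unitFamily : Idx × Idx × Idx → Fin 3 → M
  unitFamily (a , b , d) = unit a ∷ unit b ∷ unit d ∷ []

  unitFamily-∀ : ∀ {P : M → Set ℓ} → (∀ a → P (unit a)) → ∀ q k → P (unitFamily q k)
  unitFamily-∀ P-unit (a , b , d) 0F = P-unit a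
  unitFamily-∀ P-unit (a , b , d) 1F = P-unit b
  unitFamily-∀ P-unit (a , b , d) 2F = P-unit d

  permutedTensor-decomposableAut : ∀ τ {φ ψ} → FactorInverses φ ψ →
    PermutedTensorTriLinear τ → PermutedTensorTriLinear (flip τ) →
    IsDecomposableAut (linExt (permutedTensor τ φ))
  permutedTensor-decomposableAut τ {φ} {ψ} inverses τ-lin τ⁻¹-lin = isLinIso , decomposition
    where
    open FactorInverses inverses

    τ⁻¹ : Fin 3 → Fin 3
    τ⁻¹ = τ ⟨$⟩ˡ_

    f g : M → M → M → L
    f = permutedTensor τ φ
    g = permutedTensor (flip τ) (ψ ∘ τ⁻¹)

    f-lin : TriBasisLinear f
    f-lin = τ-lin φ-linear

    g-lin : TriBasisLinear g
    g-lin = τ⁻¹-lin (ψ-linear ∘ τ⁻¹)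

    g∘f-unit : ∀ q → linExt g (linExt-kernel f q) ≈L unitTensor q
    g∘f-unit q@(_ , _ , _) = ≈ᵛ.trans
      (permutedTensor-action (flip τ) (ψ ∘ τ⁻¹) g-lin (λ k → φ (τ⁻¹ k) (unitFamily q (τ⁻¹ k))))
      (⊗ᶠ-cong (λ k → ≈ᵛ.trans
        (≡⇒≈ᵛ (≡.cong (λ i → ψ i (φ i (unitFamily q i))) (inverseˡ τ {k})))
        (unitFamily-∀ {λ m → ψ k (φ k m) ≈ᵛ m} (ψ∘φ k) q k)))

    f∘g-unit : ∀ q → linExt f (linExt-kernel g q) ≈L unitTensor q
    f∘g-unit q@(_ , _ , _) = ≈ᵛ.trans
      (permutedTensor-action τ φ f-lin (λ k → ψ (τ⁻¹ (τ ⟨$⟩ʳ k)) (unitFamily q (τ ⟨$⟩ʳ k))))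
      (⊗ᶠ-cong (λ k → ≈ᵛ.trans
        (≡⇒≈ᵛ (≡.cong (λ m → φ (τ⁻¹ k) (ψ (τ⁻¹ m) (unitFamily q m))) (inverseʳ τ {k})))
        (unitFamily-∀ {λ m → φ (τ⁻¹ k) (ψ (τ⁻¹ k) m) ≈ᵛ m} (φ∘ψ (τ⁻¹ k)) q k)))

    isLinIso : IsLinIso (linExt f)
    isLinIso = record
      { linear   = linExt-isLinear f
      ; inv      = linExt g
      ; inv-cong = IsLinear.cong (linExt-isLinear g)
      ; inv-l    = linExt-inverse f g g∘f-unit
      ; inv-r    = linExt-inverse g f f∘g-unit
      }

    decomposition : Decomposition (linExt f)
    decomposition = record
      { τ      = τ
      ; φ      = φ
      ; φ-iso  = λ i → basisLinear⇒isLinIso (φ-linear i) (ψ-linear i) (ψ∘φ i) (φ∘ψ i)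
      ; action = permutedTensor-action τ φ f-lin
      }

  -- Integer matrix expressions, evaluated in K and decided in ℤ

  infixl 6 _⊕_ _⊖_
  infixl 7 _⊛_
  infix  8 ⊝_

  data MatExpr : Set where
    unitˣ       : Idx → MatExpr
    _⊕_ _⊖_ _⊛_ : MatExpr → MatExpr → MatExpr
    ⊝_ tr       : MatExpr → MatExpr

  ⟦_⟧ : MatExpr → M
  ⟦ unitˣ a ⟧ = unit a
  ⟦ x ⊕ y ⟧   = ⟦ x ⟧ +ₘ ⟦ y ⟧
  ⟦ x ⊖ y ⟧   = ⟦ x ⟧ -ₘ ⟦ y ⟧
  ⟦ x ⊛ y ⟧   = ⟦ x ⟧ ·ₘ ⟦ y ⟧
  ⟦ ⊝ x ⟧     = -ₘ ⟦ x ⟧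
  ⟦ tr x ⟧    = ⟦ x ⟧ ᵗ

  δℤ : ∀ {n} → Fin n → Fin n → ℤ
  δℤ zero    zero    = + 1
  δℤ (suc i) (suc j) = δℤ i j
  δℤ zero    (suc j) = + 0
  δℤ (suc i) zero    = + 0

  δ-fromℤ : ∀ {n} (i j : Fin n) → δ i j ≈ fromℤ (δℤ i j)
  δ-fromℤ zero    zero    = refl
  δ-fromℤ (suc i) (suc j) = δ-fromℤ i j
  δ-fromℤ zero    (suc j) = refl
  δ-fromℤ (suc i) zero    = refl

  Table : Set
  Table = Vec (Vec ℤ 3) 3

  tabulate : (Idx → ℤ) → Table
  tabulate f = Vec.tabulate λ i → Vec.tabulate λ j → f (i , j)

  entry : Table → Idx → ℤ
  entry A (i , j) = Vec.lookup (Vec.lookup A i) j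

  entry-tabulate : ∀ f p → entry (tabulate f) p ≡ f p
  entry-tabulate f (i , j) =
    ≡.trans (≡.cong (λ row → Vec.lookup row j) (Vec.lookup∘tabulate (λ i → Vec.tabulate λ j → f (i , j)) i))
            (Vec.lookup∘tabulate (λ j → f (i , j)) j)

  -- The operations take evaluated tables as arguments, so that each subexpression is
  -- evaluated once however often its entries are used.
  unitᵗ : Idx → Table
  unitᵗ a = tabulate λ p → δℤ (proj₁ a) (proj₁ p) ℤ.* δℤ (proj₂ a) (proj₂ p)

  zipᵗ : (ℤ → ℤ → ℤ) → Table → Table → Table
  zipᵗ _∙_ A B = tabulate λ p → entry A p ∙ entry B p

  mulᵗ : Table → Table → Table
  mulᵗ A B = tabulate λ p → entry A (proj₁ p , 0F) ℤ.* entry B (0F , proj₂ p)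
                      ℤ.+ (entry A (proj₁ p , 1F) ℤ.* entry B (1F , proj₂ p)
                      ℤ.+ entry A (proj₁ p , 2F) ℤ.* entry B (2F , proj₂ p))

  negᵗ trᵗ : Table → Table
  negᵗ A = tabulate λ p → ℤ.- entry A p
  trᵗ A  = tabulate λ p → entry A (proj₂ p , proj₁ p)

  entry-unitᵗ : ∀ a p → entry (unitᵗ a) p ≡ δℤ (proj₁ a) (proj₁ p) ℤ.* δℤ (proj₂ a) (proj₂ p)
  entry-unitᵗ a = entry-tabulate (λ p → δℤ (proj₁ a) (proj₁ p) ℤ.* δℤ (proj₂ a) (proj₂ p))

  entry-zipᵗ : ∀ _∙_ A B p → entry (zipᵗ _∙_ A B) p ≡ entry A p ∙ entry B p
  entry-zipᵗ _∙_ A B = entry-tabulate (λ p → entry A p ∙ entry B p)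

  entry-mulᵗ : ∀ A B p → entry (mulᵗ A B) p ≡ entry A (proj₁ p , 0F) ℤ.* entry B (0F , proj₂ p)
                                             ℤ.+ (entry A (proj₁ p , 1F) ℤ.* entry B (1F , proj₂ p)
                                             ℤ.+ entry A (proj₁ p , 2F) ℤ.* entry B (2F , proj₂ p))
  entry-mulᵗ A B = entry-tabulate (λ p → entry A (proj₁ p , 0F) ℤ.* entry B (0F , proj₂ p)
                                     ℤ.+ (entry A (proj₁ p , 1F) ℤ.* entry B (1F , proj₂ p)
                                     ℤ.+ entry A (proj₁ p , 2F) ℤ.* entry B (2F , proj₂ p)))

  entry-negᵗ : ∀ A p → entry (negᵗ A) p ≡ ℤ.- entry A p
  entry-negᵗ A = entry-tabulate (λ p → ℤ.- entry A p)

  entry-trᵗ : ∀ A p → entry (trᵗ A) p ≡ entry A (proj₂ p , proj₁ p)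
  entry-trᵗ A = entry-tabulate (λ p → entry A (proj₂ p , proj₁ p))

  ⟦_⟧ℤ : MatExpr → Table
  ⟦ unitˣ a ⟧ℤ = unitᵗ a
  ⟦ x ⊕ y ⟧ℤ   = zipᵗ ℤ._+_ ⟦ x ⟧ℤ ⟦ y ⟧ℤ
  ⟦ x ⊖ y ⟧ℤ   = zipᵗ ℤ._-_ ⟦ x ⟧ℤ ⟦ y ⟧ℤ
  ⟦ x ⊛ y ⟧ℤ   = mulᵗ ⟦ x ⟧ℤ ⟦ y ⟧ℤ
  ⟦ ⊝ x ⟧ℤ     = negᵗ ⟦ x ⟧ℤ
  ⟦ tr x ⟧ℤ    = trᵗ ⟦ x ⟧ℤ

  ⟦⟧-fromℤ : ∀ x p → ⟦ x ⟧ p ≈ fromℤ (entry ⟦ x ⟧ℤ p)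
  ⟦⟧-fromℤ (unitˣ (i , j)) p@(k , l) = begin
    δ i k * δ j l                       ≈⟨ *-cong (δ-fromℤ i k) (δ-fromℤ j l) ⟩
    fromℤ (δℤ i k) * fromℤ (δℤ j l)     ≈⟨ fromℤ-* (δℤ i k) (δℤ j l) ⟨
    fromℤ (δℤ i k ℤ.* δℤ j l)           ≡⟨ ≡.cong fromℤ (entry-unitᵗ (i , j) p) ⟨
    fromℤ (entry ⟦ unitˣ (i , j) ⟧ℤ p)  ∎
  ⟦⟧-fromℤ (x ⊕ y) p = begin
    ⟦ x ⟧ p + ⟦ y ⟧ p                            ≈⟨ +-cong (⟦⟧-fromℤ x p) (⟦⟧-fromℤ y p) ⟩
    fromℤ (entry ⟦ x ⟧ℤ p) + fromℤ (entry ⟦ y ⟧ℤ p) ≈⟨ fromℤ-+ (entry ⟦ x ⟧ℤ p) (entry ⟦ y ⟧ℤ p) ⟨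
    fromℤ (entry ⟦ x ⟧ℤ p ℤ.+ entry ⟦ y ⟧ℤ p)     ≡⟨ ≡.cong fromℤ (entry-zipᵗ ℤ._+_ ⟦ x ⟧ℤ ⟦ y ⟧ℤ p) ⟨
    fromℤ (entry ⟦ x ⊕ y ⟧ℤ p)                    ∎
  ⟦⟧-fromℤ (x ⊖ y) p = begin
    ⟦ x ⟧ p - ⟦ y ⟧ p
      ≈⟨ +-cong (⟦⟧-fromℤ x p) (-‿cong (⟦⟧-fromℤ y p)) ⟩
    fromℤ (entry ⟦ x ⟧ℤ p) - fromℤ (entry ⟦ y ⟧ℤ p)
      ≈⟨ +-congˡ (fromℤ-neg (entry ⟦ y ⟧ℤ p)) ⟨
    fromℤ (entry ⟦ x ⟧ℤ p) + fromℤ (ℤ.- entry ⟦ y ⟧ℤ p)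
      ≈⟨ fromℤ-+ (entry ⟦ x ⟧ℤ p) (ℤ.- entry ⟦ y ⟧ℤ p) ⟨
    fromℤ (entry ⟦ x ⟧ℤ p ℤ.- entry ⟦ y ⟧ℤ p)
      ≡⟨ ≡.cong fromℤ (entry-zipᵗ ℤ._-_ ⟦ x ⟧ℤ ⟦ y ⟧ℤ p) ⟨
    fromℤ (entry ⟦ x ⊖ y ⟧ℤ p) ∎
  ⟦⟧-fromℤ (x ⊛ y) p@(i , j) = begin
    Σ₃ (λ k → ⟦ x ⟧ (i , k) * ⟦ y ⟧ (k , j))
      ≈⟨ sum-cong Σ₃ˢ (λ k → trans (*-cong (⟦⟧-fromℤ x (i , k)) (⟦⟧-fromℤ y (k , j)))
                                   (sym (fromℤ-* (X k) (Y k)))) ⟩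
    Σ₃ (λ k → fromℤ (X k ℤ.* Y k))
      ≈⟨ trans (+-congˡ (sym (fromℤ-+ (X 1F ℤ.* Y 1F) (X 2F ℤ.* Y 2F))))
               (sym (fromℤ-+ (X 0F ℤ.* Y 0F) _)) ⟩
    fromℤ (X 0F ℤ.* Y 0F ℤ.+ (X 1F ℤ.* Y 1F ℤ.+ X 2F ℤ.* Y 2F))
      ≡⟨ ≡.cong fromℤ (entry-mulᵗ ⟦ x ⟧ℤ ⟦ y ⟧ℤ p) ⟨
    fromℤ (entry ⟦ x ⊛ y ⟧ℤ p) ∎
    where
    X Y : Fin 3 → ℤ
    X k = entry ⟦ x ⟧ℤ (i , k)
    Y k = entry ⟦ y ⟧ℤ (k , j)
  ⟦⟧-fromℤ (⊝ x) p = begin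
    - ⟦ x ⟧ p                      ≈⟨ -‿cong (⟦⟧-fromℤ x p) ⟩
    - fromℤ (entry ⟦ x ⟧ℤ p)       ≈⟨ fromℤ-neg (entry ⟦ x ⟧ℤ p) ⟨
    fromℤ (ℤ.- entry ⟦ x ⟧ℤ p)     ≡⟨ ≡.cong fromℤ (entry-negᵗ ⟦ x ⟧ℤ p) ⟨
    fromℤ (entry ⟦ ⊝ x ⟧ℤ p)       ∎
  ⟦⟧-fromℤ (tr x) p@(i , j) =
    trans (⟦⟧-fromℤ x (j , i)) (reflexive (≡.cong fromℤ (≡.sym (entry-trᵗ ⟦ x ⟧ℤ p))))

  all-Idx? : ∀ {p} {P : Idx → Set p} → (∀ a → Dec (P a)) → Dec (∀ a → P a)
  all-Idx? P? = map′ (λ h (i , j) → h i j) (λ h i j → h (i , j)) (all? λ i → all? λ j → P? (i , j))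

  sameEntries? : ∀ A B → Dec (∀ p → entry A p ≡ entry B p)
  sameEntries? A B = all-Idx? (λ p → entry A p ℤ.≟ entry B p)

  infix 4 _≋_ _≋?_

  _≋_ : MatExpr → MatExpr → Set
  x ≋ y = ∀ p → entry ⟦ x ⟧ℤ p ≡ entry ⟦ y ⟧ℤ p

  _≋?_ : ∀ x y → Dec (x ≋ y)
  x ≋? y = sameEntries? ⟦ x ⟧ℤ ⟦ y ⟧ℤ

  ≋⇒≈ᵛ : ∀ {x y} → x ≋ y → ⟦ x ⟧ ≈ᵛ ⟦ y ⟧
  ≋⇒≈ᵛ {x} {y} x≋y p = trans (⟦⟧-fromℤ x p) (trans (reflexive (≡.cong fromℤ (x≋y p))) (sym (⟦⟧-fromℤ y p)))

  TensorExpr : Set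
  TensorExpr = Fin 3 → MatExpr

  ⟦_⟧ᵀ : TensorExpr → L
  ⟦ t ⟧ᵀ = ⊗ᶠ (λ k → ⟦ t k ⟧)

  ⟦_⟧ᵀℤ : TensorExpr → Fin 3 → Table
  ⟦ t ⟧ᵀℤ = ⟦ t 0F ⟧ℤ ∷ ⟦ t 1F ⟧ℤ ∷ ⟦ t 2F ⟧ℤ ∷ []

  tensorEntry : (Fin 3 → Table) → Idx × Idx × Idx → ℤ
  tensorEntry A (p , q , r) = entry (A 0F) p ℤ.* entry (A 1F) q ℤ.* entry (A 2F) r

  ⟦⟧ᵀ-fromℤ : ∀ t w → ⟦ t ⟧ᵀ w ≈ fromℤ (tensorEntry ⟦ t ⟧ᵀℤ w)
  ⟦⟧ᵀ-fromℤ t (p , q , r) = begin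
    ⟦ t 0F ⟧ p * ⟦ t 1F ⟧ q * ⟦ t 2F ⟧ r
      ≈⟨ *-cong (*-cong (⟦⟧-fromℤ (t 0F) p) (⟦⟧-fromℤ (t 1F) q)) (⟦⟧-fromℤ (t 2F) r) ⟩
    fromℤ (X p) * fromℤ (Y q) * fromℤ (Z r)
      ≈⟨ *-congʳ (fromℤ-* (X p) (Y q)) ⟨
    fromℤ (X p ℤ.* Y q) * fromℤ (Z r)
      ≈⟨ fromℤ-* (X p ℤ.* Y q) (Z r) ⟨
    fromℤ (X p ℤ.* Y q ℤ.* Z r) ∎
    where
    X Y Z : Idx → ℤ
    X = entry ⟦ t 0F ⟧ℤ
    Y = entry ⟦ t 1F ⟧ℤ
    Z = entry ⟦ t 2F ⟧ℤ

  infix 4 _≋ᵀ_ _≋ᵀ?_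

  _≋ᵀ_ : TensorExpr → TensorExpr → Set
  s ≋ᵀ t = ∀ w → tensorEntry ⟦ s ⟧ᵀℤ w ≡ tensorEntry ⟦ t ⟧ᵀℤ w

  sameTensorEntries? : ∀ A B → Dec (∀ w → tensorEntry A w ≡ tensorEntry B w)
  sameTensorEntries? A B = map′ (λ h (p , q , r) → h p q r) (λ h p q r → h (p , q , r))
    (all-Idx? λ p → all-Idx? λ q → all-Idx? λ r → tensorEntry A (p , q , r) ℤ.≟ tensorEntry B (p , q , r))

  _≋ᵀ?_ : ∀ s t → Dec (s ≋ᵀ t)
  s ≋ᵀ? t = sameTensorEntries? ⟦ s ⟧ᵀℤ ⟦ t ⟧ᵀℤ

  ≋ᵀ⇒≈L : ∀ {s t} → s ≋ᵀ t → ⟦ s ⟧ᵀ ≈L ⟦ t ⟧ᵀ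
  ≋ᵀ⇒≈L {s} {t} s≋t w = trans (⟦⟧ᵀ-fromℤ s w) (trans (reflexive (≡.cong fromℤ (s≋t w))) (sym (⟦⟧ᵀ-fromℤ t w)))

  infixr 9 _∘ᵐ_

  data MatMap : Set where
    left right : MatExpr → MatMap
    transposeᵐ : MatMap
    _∘ᵐ_       : MatMap → MatMap → MatMap

  ⟦_⟧ᵐ : MatMap → M → M
  ⟦ left a ⟧ᵐ x  = ⟦ a ⟧ ·ₘ x
  ⟦ right a ⟧ᵐ x = x ·ₘ ⟦ a ⟧
  ⟦ transposeᵐ ⟧ᵐ x = x ᵗ
  ⟦ l ∘ᵐ m ⟧ᵐ x  = ⟦ l ⟧ᵐ (⟦ m ⟧ᵐ x)

  apply : MatMap → MatExpr → MatExpr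
  apply (left a) x  = a ⊛ x
  apply (right a) x = x ⊛ a
  apply transposeᵐ x = tr x
  apply (l ∘ᵐ m) x  = apply l (apply m x)

  apply-⟦⟧ : ∀ l x → ⟦ l ⟧ᵐ ⟦ x ⟧ ≡ ⟦ apply l x ⟧
  apply-⟦⟧ (left a) x  = ≡.refl
  apply-⟦⟧ (right a) x = ≡.refl
  apply-⟦⟧ transposeᵐ x = ≡.refl
  apply-⟦⟧ (l ∘ᵐ m) x  = ≡.trans (≡.cong ⟦ l ⟧ᵐ (apply-⟦⟧ m x)) (apply-⟦⟧ l (apply m x))

  ⟦⟧ᵐ-basisLinear : ∀ l → BasisLinear ⟦ l ⟧ᵐ
  ⟦⟧ᵐ-basisLinear (left a)  = basisLinear-·ₘˡ ⟦ a ⟧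
  ⟦⟧ᵐ-basisLinear (right a) = basisLinear-·ₘʳ ⟦ a ⟧
  ⟦⟧ᵐ-basisLinear transposeᵐ = basisLinear-ᵗ
  ⟦⟧ᵐ-basisLinear (l ∘ᵐ m)  = basisLinear-∘ (⟦⟧ᵐ-basisLinear l) (⟦⟧ᵐ-basisLinear m)

  InverseOnUnits : MatMap → MatMap → Set
  InverseOnUnits l m = ∀ a → apply l (apply m (unitˣ a)) ≋ unitˣ a

  inverseOnUnits? : ∀ l m → Dec (InverseOnUnits l m)
  inverseOnUnits? l m = all-Idx? (λ a → apply l (apply m (unitˣ a)) ≋? unitˣ a)

  inverseOnUnits-sound : ∀ l m → InverseOnUnits l m → ∀ a → ⟦ l ⟧ᵐ (⟦ m ⟧ᵐ (unit a)) ≈ᵛ unit a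
  inverseOnUnits-sound l m lm a = ≈ᵛ.trans
    (≡⇒≈ᵛ (≡.trans (≡.cong ⟦ l ⟧ᵐ (apply-⟦⟧ m (unitˣ a))) (apply-⟦⟧ l (apply m (unitˣ a)))))
    (≋⇒≈ᵛ {apply l (apply m (unitˣ a))} {unitˣ a} (lm a))

  factorInverses : ∀ (φ ψ : Fin 3 → MatMap) →
    (∀ i → InverseOnUnits (ψ i) (φ i)) → (∀ i → InverseOnUnits (φ i) (ψ i)) →
    FactorInverses (⟦_⟧ᵐ ∘ φ) (⟦_⟧ᵐ ∘ ψ)
  factorInverses φ ψ ψφ φψ = record
    { φ-linear = ⟦⟧ᵐ-basisLinear ∘ φ
    ; ψ-linear = ⟦⟧ᵐ-basisLinear ∘ ψ
    ; ψ∘φ      = λ i → inverseOnUnits-sound (ψ i) (φ i) (ψφ i)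
    ; φ∘ψ      = λ i → inverseOnUnits-sound (φ i) (ψ i) (φψ i)
    }

  permutedᵀ : Permutation′ 3 → (Fin 3 → MatMap) → TensorExpr → TensorExpr
  permutedᵀ τ φ t k = apply (φ (τ ⟨$⟩ˡ k)) (t (τ ⟨$⟩ˡ k))

  permutedTensor-⟦⟧ᵀ : ∀ τ φ → TriBasisLinear (permutedTensor τ (⟦_⟧ᵐ ∘ φ)) → ∀ t →
    linExt (permutedTensor τ (⟦_⟧ᵐ ∘ φ)) ⟦ t ⟧ᵀ ≈L ⟦ permutedᵀ τ φ t ⟧ᵀ
  permutedTensor-⟦⟧ᵀ τ φ f-lin t = ≈ᵛ.trans (permutedTensor-action τ (⟦_⟧ᵐ ∘ φ) f-lin (λ k → ⟦ t k ⟧))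
    (⊗ᶠ-cong (λ k → ≡⇒≈ᵛ (apply-⟦⟧ (φ (τ ⟨$⟩ˡ k)) (t (τ ⟨$⟩ˡ k)))))

  e11 e12 e13 e21 e22 e23 e31 e32 e33 : MatExpr
  e11 = unitˣ (0F , 0F)
  e12 = unitˣ (0F , 1F)
  e13 = unitˣ (0F , 2F)
  e21 = unitˣ (1F , 0F)
  e22 = unitˣ (1F , 1F)
  e23 = unitˣ (1F , 2F)
  e31 = unitˣ (2F , 0F)
  e32 = unitˣ (2F , 1F)
  e33 = unitˣ (2F , 2F)

  ladermanˣ : Fin 23 → TensorExpr
  ladermanˣ =
    ((e11 ⊕ e12 ⊕ e13 ⊖ e21 ⊖ e22 ⊖ e32 ⊖ e33) ∷ e22 ∷ e21 ∷ []) ∷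
    ((e11 ⊖ e21) ∷ (⊝ e12 ⊕ e22) ∷ (e12 ⊕ e22) ∷ []) ∷
    (e22 ∷ (⊝ e11 ⊕ e12 ⊕ e21 ⊖ e22 ⊖ e23 ⊖ e31 ⊕ e33) ∷ e12 ∷ []) ∷
    ((⊝ e11 ⊕ e21 ⊕ e22) ∷ (e11 ⊖ e12 ⊕ e22) ∷ (e21 ⊕ e12 ⊕ e22) ∷ []) ∷
    ((e21 ⊕ e22) ∷ (⊝ e11 ⊕ e12) ∷ (e21 ⊕ e22) ∷ []) ∷
    (e11 ∷ e11 ∷ (e11 ⊕ e21 ⊕ e31 ⊕ e12 ⊕ e22 ⊕ e13 ⊕ e33) ∷ []) ∷
    ((⊝ e11 ⊕ e31 ⊕ e32) ∷ (e11 ⊖ e13 ⊕ e23) ∷ (e31 ⊕ e13 ⊕ e33) ∷ []) ∷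
    ((⊝ e11 ⊕ e31) ∷ (e13 ⊖ e23) ∷ (e13 ⊕ e33) ∷ []) ∷
    ((e31 ⊕ e32) ∷ (⊝ e11 ⊕ e13) ∷ (e31 ⊕ e33) ∷ []) ∷
    ((e11 ⊕ e12 ⊕ e13 ⊖ e22 ⊖ e23 ⊖ e31 ⊖ e32) ∷ e23 ∷ e31 ∷ []) ∷
    (e32 ∷ (⊝ e11 ⊕ e13 ⊕ e21 ⊖ e22 ⊖ e23 ⊖ e31 ⊕ e32) ∷ e13 ∷ []) ∷
    ((⊝ e13 ⊕ e32 ⊕ e33) ∷ (e22 ⊕ e31 ⊖ e32) ∷ (e21 ⊕ e13 ⊕ e23) ∷ []) ∷
    ((e13 ⊖ e33) ∷ (e22 ⊖ e32) ∷ (e13 ⊕ e23) ∷ []) ∷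
    (e13 ∷ e31 ∷ (e11 ⊕ e21 ⊕ e31 ⊕ e12 ⊕ e32 ⊕ e13 ⊕ e23) ∷ []) ∷
    ((e32 ⊕ e33) ∷ (⊝ e31 ⊕ e32) ∷ (e21 ⊕ e23) ∷ []) ∷
    ((⊝ e13 ⊕ e22 ⊕ e23) ∷ (e23 ⊕ e31 ⊖ e33) ∷ (e31 ⊕ e12 ⊕ e32) ∷ []) ∷
    ((e13 ⊖ e23) ∷ (e23 ⊖ e33) ∷ (e12 ⊕ e32) ∷ []) ∷
    ((e22 ⊕ e23) ∷ (⊝ e31 ⊕ e33) ∷ (e31 ⊕ e32) ∷ []) ∷
    (e12 ∷ e21 ∷ e11 ∷ []) ∷
    (e23 ∷ e32 ∷ e22 ∷ []) ∷
    (e21 ∷ e13 ∷ e32 ∷ []) ∷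
    (e31 ∷ e12 ∷ e23 ∷ []) ∷
    (e33 ∷ e33 ∷ e33 ∷ []) ∷ []

  Laderman-tabulate : Laderman ≡ List.tabulate (⟦_⟧ᵀ ∘ ladermanˣ)
  Laderman-tabulate = ≡.refl

  permutes⇒preserves𝓛 : ∀ {g} (act : TensorExpr → TensorExpr) (σ ρ : Fin 23 → Fin 23) →
    (∀ t → g ⟦ t ⟧ᵀ ≈L ⟦ act t ⟧ᵀ) → (∀ i → act (ladermanˣ i) ≋ᵀ ladermanˣ (σ i)) →
    (∀ j → σ (ρ j) ≡ j) → Preserves𝓛 g
  permutes⇒preserves𝓛 {g} act σ ρ g-act act≋ σρ =
    ≡.subst (λ xs → Preserves xs g) (≡.sym Laderman-tabulate)
      (preserves-tabulate (⟦_⟧ᵀ ∘ ladermanˣ) σ ρ g-permutes σρ)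
    where
    g-permutes : ∀ i → g ⟦ ladermanˣ i ⟧ᵀ ≈L ⟦ ladermanˣ (σ i) ⟧ᵀ
    g-permutes i = ≈ᵛ.trans (g-act (ladermanˣ i)) (≋ᵀ⇒≈L {act (ladermanˣ i)} {ladermanˣ (σ i)} (act≋ i))

  ε1ˣ ε2ˣ π12ˣ : MatExpr
  ε1ˣ  = ⊝ e11 ⊕ e22 ⊕ e33
  ε2ˣ  = e11 ⊖ e22 ⊕ e33
  π12ˣ = e12 ⊕ e21 ⊕ e33

  τ₃ τ₄ : Permutation′ 3
  τ₃ = transpose 0F 1F
  -- the 3-cycle 0 ↦ 1 ↦ 2 ↦ 0
  τ₄ = transpose 0F 1F ∘ₚ transpose 0F 2F

  φ₃ ψ₃ φ₄ ψ₄ : Fin 3 → MatMap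
  φ₃ 0F = left ε2ˣ ∘ᵐ transposeᵐ
  φ₃ 1F = right ε2ˣ ∘ᵐ transposeᵐ
  φ₃ 2F = transposeᵐ
  ψ₃ 0F = right ε2ˣ ∘ᵐ transposeᵐ
  ψ₃ 1F = left ε2ˣ ∘ᵐ transposeᵐ
  ψ₃ 2F = transposeᵐ
  φ₄ 0F = right ε1ˣ ∘ᵐ right π12ˣ ∘ᵐ left π12ˣ
  φ₄ 1F = left (ε1ˣ ⊛ π12ˣ) ∘ᵐ right ε1ˣ
  φ₄ 2F = right π12ˣ ∘ᵐ left ε1ˣ
  ψ₄ 0F = right π12ˣ ∘ᵐ right ε1ˣ ∘ᵐ left π12ˣ
  ψ₄ 1F = left (π12ˣ ⊛ ε1ˣ) ∘ᵐ right ε1ˣ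
  ψ₄ 2F = left ε1ˣ ∘ᵐ right π12ˣ

  Φ3≡ : Φ3 ≡ linExt (permutedTensor τ₃ (⟦_⟧ᵐ ∘ φ₃))
  Φ3≡ = ≡.refl

  Φ4≡ : Φ4 ≡ linExt (permutedTensor τ₄ (⟦_⟧ᵐ ∘ φ₄))
  Φ4≡ = ≡.refl

  τ₃-triLinear : PermutedTensorTriLinear τ₃
  τ₃-triLinear {φ} lin = record
    { linear₁ = λ x y z → ⊗-basisLinear₂ (lin 0F) (φ 1F y) x (φ 2F z)
    ; linear₂ = λ x y z → ⊗-basisLinear₁ (lin 1F) y (φ 0F x) (φ 2F z)
    ; linear₃ = λ x y z → ⊗-basisLinear₃ (lin 2F) (φ 1F y) (φ 0F x) z
    }

  τ₄-triLinear : PermutedTensorTriLinear τ₄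
  τ₄-triLinear {φ} lin = record
    { linear₁ = λ x y z → ⊗-basisLinear₂ (lin 0F) (φ 2F z) x (φ 1F y)
    ; linear₂ = λ x y z → ⊗-basisLinear₃ (lin 1F) (φ 2F z) (φ 0F x) y
    ; linear₃ = λ x y z → ⊗-basisLinear₁ (lin 2F) z (φ 0F x) (φ 1F y)
    }

  flip-τ₄-triLinear : PermutedTensorTriLinear (flip τ₄)
  flip-τ₄-triLinear {φ} lin = record
    { linear₁ = λ x y z → ⊗-basisLinear₃ (lin 0F) (φ 1F y) (φ 2F z) x
    ; linear₂ = λ x y z → ⊗-basisLinear₁ (lin 1F) y (φ 2F z) (φ 0F x)
    ; linear₃ = λ x y z → ⊗-basisLinear₂ (lin 2F) (φ 1F y) z (φ 0F x)
    }

  -- Indices are 0-based: entry i of a table is the index of the image of t_{i+1}.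
  σ₃ σ₄ σ₄⁻¹ : Fin 23 → Fin 23
  σ₃   = # 2 ∷ # 4 ∷ # 0 ∷ # 3 ∷ # 1 ∷ # 5 ∷ # 6 ∷ # 8 ∷ # 7 ∷ # 10 ∷ # 9 ∷ # 15 ∷
         # 17 ∷ # 13 ∷ # 16 ∷ # 11 ∷ # 14 ∷ # 12 ∷ # 18 ∷ # 19 ∷ # 21 ∷ # 20 ∷ # 22 ∷ []
  σ₄   = # 2 ∷ # 1 ∷ # 5 ∷ # 3 ∷ # 4 ∷ # 0 ∷ # 11 ∷ # 12 ∷ # 14 ∷ # 10 ∷ # 13 ∷ # 15 ∷
         # 16 ∷ # 9 ∷ # 17 ∷ # 6 ∷ # 7 ∷ # 8 ∷ # 18 ∷ # 20 ∷ # 21 ∷ # 19 ∷ # 22 ∷ []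
  σ₄⁻¹ = # 5 ∷ # 1 ∷ # 0 ∷ # 3 ∷ # 4 ∷ # 2 ∷ # 15 ∷ # 16 ∷ # 17 ∷ # 13 ∷ # 9 ∷ # 6 ∷
         # 7 ∷ # 10 ∷ # 8 ∷ # 11 ∷ # 12 ∷ # 14 ∷ # 18 ∷ # 21 ∷ # 19 ∷ # 20 ∷ # 22 ∷ []

  Φ3-aut : InAut𝓛 Φ3
  Φ3-aut = ≡.subst InAut𝓛 (≡.sym Φ3≡) (decomposableAut , preserves)
    where
    decomposableAut : IsDecomposableAut (linExt (permutedTensor τ₃ (⟦_⟧ᵐ ∘ φ₃)))
    decomposableAut = permutedTensor-decomposableAut τ₃
      (factorInverses φ₃ ψ₃ (from-yes (all? λ i → inverseOnUnits? (ψ₃ i) (φ₃ i)))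
                            (from-yes (all? λ i → inverseOnUnits? (φ₃ i) (ψ₃ i))))
      τ₃-triLinear τ₃-triLinear

    preserves : Preserves𝓛 (linExt (permutedTensor τ₃ (⟦_⟧ᵐ ∘ φ₃)))
    preserves = permutes⇒preserves𝓛 (permutedᵀ τ₃ φ₃) σ₃ σ₃
      (permutedTensor-⟦⟧ᵀ τ₃ φ₃ (τ₃-triLinear (⟦⟧ᵐ-basisLinear ∘ φ₃)))
      (from-yes (all? λ i → permutedᵀ τ₃ φ₃ (ladermanˣ i) ≋ᵀ? ladermanˣ (σ₃ i)))
      (from-yes (all? λ j → σ₃ (σ₃ j) Fin.≟ j))

  Φ4-aut : InAut𝓛 Φ4
  Φ4-aut = ≡.subst InAut𝓛 (≡.sym Φ4≡) (decomposableAut , preserves)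
    where
    decomposableAut : IsDecomposableAut (linExt (permutedTensor τ₄ (⟦_⟧ᵐ ∘ φ₄)))
    decomposableAut = permutedTensor-decomposableAut τ₄
      (factorInverses φ₄ ψ₄ (from-yes (all? λ i → inverseOnUnits? (ψ₄ i) (φ₄ i)))
                            (from-yes (all? λ i → inverseOnUnits? (φ₄ i) (ψ₄ i))))
      τ₄-triLinear flip-τ₄-triLinear

    preserves : Preserves𝓛 (linExt (permutedTensor τ₄ (⟦_⟧ᵐ ∘ φ₄)))
    preserves = permutes⇒preserves𝓛 (permutedᵀ τ₄ φ₄) σ₄ σ₄⁻¹
      (permutedTensor-⟦⟧ᵀ τ₄ φ₄ (τ₄-triLinear (⟦⟧ᵐ-basisLinear ∘ φ₄)))
      (from-yes (all? λ i → permutedᵀ τ₄ φ₄ (ladermanˣ i) ≋ᵀ? ladermanˣ (σ₄ i)))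
      (from-yes (all? λ j → σ₄ (σ₄⁻¹ j) Fin.≟ j))

  Q₁⊆Aut : ∀ {q} → InQ1 q → InAut𝓛 q
  Q₁⊆Aut gen3                      = Φ3-aut
  Q₁⊆Aut gen4                      = Φ4-aut
  Q₁⊆Aut one                       = aut-id
  Q₁⊆Aut (comp f∈Q₁ h∈Q₁)          = aut-∘ (Q₁⊆Aut f∈Q₁) (Q₁⊆Aut h∈Q₁)
  Q₁⊆Aut (inv _ f∈Q₁ h-cong fh hf) = aut-inverse (Q₁⊆Aut f∈Q₁) h-cong fh hf
  Q₁⊆Aut (resp _ f∈Q₁ f≈h)         = aut-resp (Q₁⊆Aut f∈Q₁) f≈h

  -- Every permutation of the factors is realised by Q₁

  factorPermutation : ∀ {g} → InAut𝓛 g → Permutation′ 3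
  factorPermutation ((_ , g-dec) , _) = Decomposition.τ g-dec

  RealisedInQ₁ : Permutation′ 3 → Set (c ⊔ ℓ)
  RealisedInQ₁ τ = Σ (L → L) λ q → Σ (InQ1 q) λ q∈Q₁ →
                   ∀ i → factorPermutation (Q₁⊆Aut q∈Q₁) ⟨$⟩ʳ i ≡ τ ⟨$⟩ʳ i

  realisedBy : ∀ {q} (q∈Q₁ : InQ1 q) τ →
    factorPermutation (Q₁⊆Aut q∈Q₁) ⟨$⟩ʳ 0F ≡ τ ⟨$⟩ʳ 0F →
    factorPermutation (Q₁⊆Aut q∈Q₁) ⟨$⟩ʳ 1F ≡ τ ⟨$⟩ʳ 1F → RealisedInQ₁ τ
  realisedBy q∈Q₁ τ e₀ e₁ = _ , q∈Q₁ , permutation₃-ext (factorPermutation (Q₁⊆Aut q∈Q₁)) τ e₀ e₁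

  realisedInQ₁ : ∀ τ → RealisedInQ₁ τ
  realisedInQ₁ τ with τ ⟨$⟩ʳ 0F in e₀ | τ ⟨$⟩ʳ 1F in e₁
  ... | 0F | 0F = contradiction (⟨$⟩ʳ-injective τ (≡.trans e₀ (≡.sym e₁))) λ ()
  ... | 0F | 1F = realisedBy one                τ (≡.sym e₀) (≡.sym e₁)
  ... | 0F | 2F = realisedBy (comp gen3 gen4)   τ (≡.sym e₀) (≡.sym e₁)
  ... | 1F | 0F = realisedBy gen3               τ (≡.sym e₀) (≡.sym e₁)
  ... | 1F | 1F = contradiction (⟨$⟩ʳ-injective τ (≡.trans e₀ (≡.sym e₁))) λ ()
  ... | 1F | 2F = realisedBy gen4               τ (≡.sym e₀) (≡.sym e₁)
  ... | 2F | 0F = realisedBy (comp gen4 gen4)   τ (≡.sym e₀) (≡.sym e₁)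
  ... | 2F | 1F = realisedBy (comp gen4 gen3)   τ (≡.sym e₀) (≡.sym e₁)
  ... | 2F | 2F = contradiction (⟨$⟩ʳ-injective τ (≡.trans e₀ (≡.sym e₁))) λ ()

  Aut₀Q₁⊆Aut : ∀ g₀ q → InAut𝓛₀ g₀ → InQ1 q → InAut𝓛 (g₀ ∘ q)
  Aut₀Q₁⊆Aut g₀ q (g₀-iso , g₀-pres , g₀-dec , _) q∈Q₁ =
    aut-∘ ((g₀-iso , g₀-dec) , g₀-pres) (Q₁⊆Aut q∈Q₁)

  -- g = (g ∘ q⁻¹) ∘ q for the q ∈ Q₁ permuting the factors as g does.
  Aut⊆Aut₀Q₁ : ∀ g → InAut𝓛 g → Σ (L → L) λ g₀ → Σ (L → L) λ q →
                 InAut𝓛₀ g₀ × InQ1 q × (∀ T → g T ≈L g₀ (q T))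
  Aut⊆Aut₀Q₁ g g-aut@((g-iso , _) , _) with realisedInQ₁ (factorPermutation g-aut)
  ... | q , q∈Q₁ , same-τ = g ∘ q⁻¹ , q , (g₀-iso , g₀-pres , g₀-dec , g₀-fixes) , q∈Q₁ ,
                            λ T → ≈ᵛ.sym (IsLinear.cong (IsLinIso.linear g-iso) (q⁻¹.inv-l T))
    where
    q-aut : InAut𝓛 q
    q-aut = Q₁⊆Aut q∈Q₁

    module q⁻¹ = IsLinIso (proj₁ (proj₁ q-aut))

    q⁻¹ : L → L
    q⁻¹ = q⁻¹.inv

    g₀-aut : InAut𝓛 (g ∘ q⁻¹)
    g₀-aut = aut-∘ g-aut (aut-inverse q-aut q⁻¹.inv-cong q⁻¹.inv-r q⁻¹.inv-l)

    g₀-iso : IsLinIso (g ∘ q⁻¹)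
    g₀-iso = proj₁ (proj₁ g₀-aut)

    g₀-dec : Decomposition (g ∘ q⁻¹)
    g₀-dec = proj₂ (proj₁ g₀-aut)

    g₀-pres : Preserves𝓛 (g ∘ q⁻¹)
    g₀-pres = proj₂ g₀-aut

    g₀-fixes : ∀ i → Decomposition.τ g₀-dec ⟨$⟩ʳ i ≡ i
    g₀-fixes i = ≡.trans (≡.sym (same-τ (factorPermutation q-aut ⟨$⟩ˡ i)))
                         (inverseʳ (factorPermutation q-aut))

lemma5p8 : ∀ {c ℓ} (F : Field c ℓ) → Setup.Aut𝓛≡Aut𝓛₀Q1 F
lemma5p8 F = Aut⊆Aut₀Q₁ , Aut₀Q₁⊆Aut
  where open Automorphisms F using (Aut⊆Aut₀Q₁; Aut₀Q₁⊆Aut)
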